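{- The linear map $\Delta:\Phi\mathbf{Sym}\to\Phi\mathbf{Sym}\otimes\Phi\mathbf{Sym}$ defined below is an algebra morphism, so that $\Phi\mathbf{Sym}$ is a graded bialgebra (with $\deg\phi_\sigma=n$ for $\sigma\in\mathfrak S_n$). Moreover $\Delta$ is cocommutative.
   Context: Let $\mathbb K$ be a field of characteristic zero and $a_{i\,j}$ ($i,j\ge1$) non-commuting indeterminates; for words $x=x_1\cdots x_n$, $a=a_1\cdots a_n$ of positive integers, $\binom{x}{a}=a_{x_1\,a_1}\cdots a_{x_n\,a_n}$. $\mathrm{Std}(w)$ is the standardization of a word (letters numbered increasingly, ties left to right). A cycle $(c_1\cdots c_k)$ maps $c_1\mapsto c_2\mapsto\cdots\mapsto c_k\mapsto c_1$; its cycle words are its cyclic rotations. For $\sigma\in\mathfrak S_n$, $\phi_\sigma=\sum\binom{x}{a}$ over pairs of words $x,a$ of length $n$ with (i) $x_i=x_j$ iff $i,j$ in the same cycle of $\sigma$; (ii) for each cycle $c$ of $\sigma$ with support $\{p_1<\cdots<p_k\}$, $\mathrm{Std}(a_{p_1}\cdots a_{p_k})^{ -1}$ is a cycle word of the cycle on $[k]$ obtained from $c$ by $p_r\mapsto r$; $\phi_\emptyset=1$. The $\phi_\sigma$ form a basis of a subalgebra $\Phi\mathbf{Sym}$ of $\mathbb K\langle a_{i\,j}\rangle$. For $\sigma\in\mathfrak S_n$ and a subset $S$ of the set of cycles of $\sigma$, let $\sigma_S$ be the permutation obtained from the restriction of $\sigma$ to the union $U$ of the supports of the cycles in $S$ by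 relabelling $U$ through the increasing bijection $U\to[|U|]$. Define $\Delta\phi_\sigma=\sum_S\phi_{\sigma_S}\otimes\phi_{\sigma_{\bar S}}$, the sum over all subsets $S$ of the set of cycles of $\sigma$, $\bar S$ the complementary subset; counit $\varepsilon(\phi_\sigma)=0$ for $n\ge1$, $\varepsilon(1)=1$. (Equivalently, $\Delta$ comes from replacing the alphabet of first letters by an ordered sum of two mutually commuting alphabets.) -}

module Defs where

open import Level using (Level; _⊔_)
open import Data.Nat as ℕ using (ℕ; zero; suc; _≡ᵇ_; _<ᵇ_)
open import Data.Bool using (Bool; true; false; _∧_; _∨_; not; if_then_else_)
open import Data.List using (List; []; _∷_; map; length; upTo; filterᵇ; concat; concatMap; take; drop; foldr; null)
open import Data.Bool.ListAction using (any; all)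
open import Data.List.Relation.Binary.Permutation.Propositional using (_↭_)
open import Data.Product using (_×_; _,_; proj₁; proj₂; Σ; ∃)
open import Relation.Nullary using (¬_)
open import Relation.Binary.PropositionalEquality using (_≡_)
open import Algebra.Bundles using (CommutativeRing)

record Field (c ℓ : Level) : Set (Level.suc (c ⊔ ℓ)) where
  field
    commutativeRing : CommutativeRing c ℓ
  open CommutativeRing commutativeRing public
  field
    1≉0     : ¬ (1# ≈ 0#)
    inverse : ∀ x → ¬ (x ≈ 0#) → ∃ λ y → x * y ≈ 1#

ℕ→R : ∀ {c ℓ} (R : CommutativeRing c ℓ) → ℕ → CommutativeRing.Carrier R
ℕ→R R zero    = CommutativeRing.0# R
ℕ→R R (suc n) = CommutativeRing._+_ R (CommutativeRing.1# R) (ℕ→R R n)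

CharZero : ∀ {c ℓ} → Field c ℓ → Set ℓ
CharZero K = ∀ n → ¬ (Field._≈_ K (ℕ→R (Field.commutativeRing K) (suc n)) (Field.0# K))

-- Words and permutations (0-based: letter/index i stands for i+1)

-- a permutation of [n] in one-line notation σ(0)…σ(n-1), values in {0,…,n-1}
IsPerm : List ℕ → Set
IsPerm σ = σ ↭ upTo (length σ)

at : List ℕ → ℕ → ℕ
at []       _       = 0
at (x ∷ xs) zero    = x
at (x ∷ xs) (suc i) = at xs i

indexOf : ℕ → List ℕ → ℕ
indexOf v []       = 0
indexOf v (x ∷ xs) = if x ≡ᵇ v then 0 else suc (indexOf v xs)

elemᵇ : ℕ → List ℕ → Bool
elemᵇ v = any (λ x → x ≡ᵇ v)

listEqᵇ : List ℕ → List ℕ → Bool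
listEqᵇ []       []       = true
listEqᵇ (x ∷ xs) (y ∷ ys) = (x ≡ᵇ y) ∧ listEqᵇ xs ys
listEqᵇ _        _        = false

pow : List ℕ → ℕ → ℕ → ℕ
pow σ zero    i = i
pow σ (suc k) i = at σ (pow σ k i)

sameCycle : List ℕ → ℕ → ℕ → Bool
sameCycle σ i j = any (λ k → pow σ k i ≡ᵇ j) (upTo (length σ))

orbit : List ℕ → ℕ → List ℕ
orbit σ i = filterᵇ (sameCycle σ i) (upTo (length σ))

isLeader : List ℕ → ℕ → Bool
isLeader σ i = not (any (λ j → sameCycle σ j i) (upTo i))

-- the cycles of σ, each given by its (sorted) support
cycles : List ℕ → List (List ℕ)
cycles σ = map (orbit σ) (filterᵇ (isLeader σ) (upTo (length σ)))

count : (ℕ → Bool) → List ℕ → ℕ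
count p []       = 0
count p (x ∷ xs) = if p x then suc (count p xs) else count p xs

Std : List ℕ → List ℕ
Std w = map (λ i → count (λ y → y <ᵇ at w i) w
                   ℕ.+ count (λ y → y ≡ᵇ at w i) (take i w))
            (upTo (length w))

inv : List ℕ → List ℕ
inv τ = map (λ r → indexOf r τ) (upTo (length τ))

-- the cycle on [k] obtained from the cycle of σ with support p by p_r ↦ r
relabel : List ℕ → List ℕ → ℕ → ℕ
relabel σ p r = indexOf (at σ (at p r)) p

cycleWordFrom : (ℕ → ℕ) → ℕ → ℕ → List ℕ
cycleWordFrom γ zero    r = []
cycleWordFrom γ (suc k) r = r ∷ cycleWordFrom γ k (γ r)

cycleWords : List ℕ → List ℕ → List (List ℕ)
cycleWords σ p = map (cycleWordFrom (relabel σ p) (length p)) (upTo (length p))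

condI : List ℕ → List ℕ → Bool
condI σ x = all (λ i → all (λ j → (at x i ≡ᵇ at x j) ∧ sameCycle σ i j
                                   ∨ not (at x i ≡ᵇ at x j) ∧ not (sameCycle σ i j))
                           (upTo (length σ)))
                (upTo (length σ))

condII : List ℕ → List ℕ → Bool
condII σ a = all (λ p → any (listEqᵇ (inv (Std (map (at a) p)))) (cycleWords σ p))
                 (cycles σ)

-- monomial a_{x1 a1} ⋯ a_{xn an} is encoded as the list [(x1,a1),…,(xn,an)]
Monomial : Set
Monomial = List (ℕ × ℕ)

isTermOf : List ℕ → Monomial → Bool
isTermOf σ w = (length w ≡ᵇ length σ) ∧ condI σ (map proj₁ w) ∧ condII σ (map proj₂ w)

-- σ_S : restriction of σ to U = union of the supports in S, relabelled increasingly
restrictTo : List ℕ → List (List ℕ) → List ℕ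
restrictTo σ S = map (λ u → indexOf (at σ u) U) U
  where U = filterᵇ (λ i → any (elemᵇ i) S) (upTo (length σ))

splits : {A : Set} → List A → List (List A × List A)
splits []       = ([] , []) ∷ []
splits (c ∷ cs) = concatMap (λ st → (c ∷ proj₁ st , proj₂ st) ∷ (proj₁ st , c ∷ proj₂ st) ∷ [])
                            (splits cs)

ΔTerms : List ℕ → List (List ℕ × List ℕ)
ΔTerms σ = map (λ st → restrictTo σ (proj₁ st) , restrictTo σ (proj₂ st)) (splits (cycles σ))

-- Series in the non-commuting a_{ij} (coefficient functions), the
-- tensor square realised as coefficient functions of pairs of monomials,
-- and the tensor cube as functions of triples.

module Series {c ℓ} (R : CommutativeRing c ℓ) where
  open CommutativeRing R

  Σl : ∀ {a} {A : Set a} → (A → Carrier) → List A → Carrier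
  Σl f = foldr (λ x s → f x + s) 0#

  Ser : Set c
  Ser = Monomial → Carrier

  Ser² : Set c
  Ser² = Monomial → Monomial → Carrier

  Ser³ : Set c
  Ser³ = Monomial → Monomial → Monomial → Carrier

  _⋆_ : Ser → Ser → Ser
  (f ⋆ g) w = Σl (λ k → f (take k w) * g (drop k w)) (upTo (suc (length w)))

  -- product in the tensor square: (a ⊗ b)(c ⊗ d) = ac ⊗ bd
  _⊛_ : Ser² → Ser² → Ser²
  (F ⊛ G) u v = Σl (λ k → Σl (λ l → F (take k u) (take l v) * G (drop k u) (drop l v))
                             (upTo (suc (length v))))
                   (upTo (suc (length u)))

  φ : List ℕ → Ser
  φ σ w = if isTermOf σ w then 1# else 0#

  ε : List ℕ → Carrier
  ε σ = if null σ then 1# else 0#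

  Δφ : List ℕ → Ser²
  Δφ σ u v = Σl (λ pq → φ (proj₁ pq) u * φ (proj₂ pq) v) (ΔTerms σ)

  lin : List (Carrier × List ℕ) → Ser
  lin cs w = Σl (λ cρ → proj₁ cρ * φ (proj₂ cρ) w) cs

  Δlin : List (Carrier × List ℕ) → Ser²
  Δlin cs u v = Σl (λ cρ → proj₁ cρ * Δφ (proj₂ cρ) u v) cs

  εlin : List (Carrier × List ℕ) → Carrier
  εlin cs = Σl (λ cρ → proj₁ cρ * ε (proj₂ cρ)) cs

  ΔidΔφ : List ℕ → Ser³
  ΔidΔφ σ u v w = Σl (λ pq → Δφ (proj₁ pq) u v * φ (proj₂ pq) w) (ΔTerms σ)

  idΔΔφ : List ℕ → Ser³
  idΔΔφ σ u v w = Σl (λ pq → φ (proj₁ pq) u * Δφ (proj₂ pq) v w) (ΔTerms σ)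

  εidΔφ : List ℕ → Ser
  εidΔφ σ w = Σl (λ pq → ε (proj₁ pq) * φ (proj₂ pq) w) (ΔTerms σ)

  idεΔφ : List ℕ → Ser
  idεΔφ σ w = Σl (λ pq → φ (proj₁ pq) w * ε (proj₂ pq)) (ΔTerms σ)

-- Δ is the coproduct of alphabet doubling. Tag the first letters of u with one
-- copy of ℕ and those of v with a disjoint copy; then Δφ_σ(u , v) is the sum of
-- φ_σ over all shuffles of the two tagged words. Indeed, a shuffle is a Boolean
-- mask on positions, condition (i) for the merged word forces the positions
-- coming from u to be a union S of cycles of σ, and then conditions (i) and (ii)
-- for σ split into those for σ_S on u and for σ_S̄ on v. Once Δ is a shuffle sum,
-- the bialgebra axioms are identities of shuffle sums: shuffling is compatible
-- with deconcatenation (multiplicativity), associative (coassociativity, using a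
-- third alphabet), trivial against the empty word (counit), and the sum over S
-- is symmetric under S ↔ S̄ (cocommutativity).

module Submission where

open import Defs
open import Level using (Level)
open import Data.Nat as ℕ using (ℕ)
open import Data.List using (List; []; length)
open import Data.List.Relation.Unary.All using (All)
open import Data.Product using (_×_; proj₁; proj₂)
open import Relation.Nullary using (¬_)
open import Relation.Binary.PropositionalEquality using (_≡_)
open import Data.Nat using (zero; suc; _<_; _≤_; _≡ᵇ_; _<ᵇ_; s≤s; z≤n; _≟_)
open import Data.Bool using (Bool; true; false; _∧_; _∨_; not; if_then_else_)
open import Data.Bool.Properties using (∧-conicalˡ; ∧-conicalʳ; ∨-conicalˡ; ∨-conicalʳ; ¬-not; ∧-zeroʳ; ∧-identityʳ; ∧-assoc; ∧-comm; ∨-assoc; ∨-comm; not-involutive)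
open import Data.Bool.ListAction using (any; all)
open import Data.List using (_∷_; map; upTo; applyUpTo; filterᵇ; take; drop; _++_; concatMap; concat)
open import Data.List.Properties using (length-map; map-∘; map-cong; map-upTo; map-applyUpTo; length-upTo; length-++; take++drop≡id)
import Data.Nat.Properties as ℕₚ
open import Data.List.Relation.Unary.AllPairs.Properties using (applyUpTo⁺₁; filter⁺)
open import Relation.Nullary.Decidable using (T?)
open import Data.List.Membership.Propositional using (_∈_)
open import Data.List.Membership.Propositional.Properties using (∈-upTo⁺; ∈-upTo⁻; ∈-map⁺; ∈-map⁻; ∈-++⁻)
open import Data.List.Relation.Unary.Any using (here; there)
import Data.List.Relation.Unary.All as AllM
import Data.List.Relation.Unary.All.Properties as AP
open import Data.List.Relation.Unary.AllPairs using (AllPairs)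
open import Data.Product using (_,_; Σ; ∃)
open import Data.Sum using (_⊎_; inj₁; inj₂)
open import Data.Empty using (⊥; ⊥-elim)
open import Relation.Nullary using (yes; no)
open import Function using (_∘_; id)
open import Algebra.Bundles using (CommutativeRing)

module Basics where

  open import Data.List.Relation.Unary.All using ([]; _∷_)
  open import Data.List.Relation.Unary.AllPairs using ([]; _∷_)
  open import Data.Nat using (_+_; _*_; _∸_)
  open import Data.Nat.Properties
  open import Relation.Binary.PropositionalEquality

  ≡ᵇ-refl : ∀ n → (n ≡ᵇ n) ≡ true
  ≡ᵇ-refl zero = refl
  ≡ᵇ-refl (suc n) = ≡ᵇ-refl n

  ≡ᵇ≡true⇒≡ : ∀ m n → (m ≡ᵇ n) ≡ true → m ≡ n
  ≡ᵇ≡true⇒≡ zero zero p = refl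
  ≡ᵇ≡true⇒≡ (suc m) (suc n) p = cong suc (≡ᵇ≡true⇒≡ m n p)
  ≡ᵇ≡true⇒≡ zero (suc n) ()
  ≡ᵇ≡true⇒≡ (suc m) zero ()

  ≡⇒≡ᵇ≡true : ∀ {m n} → m ≡ n → (m ≡ᵇ n) ≡ true
  ≡⇒≡ᵇ≡true {m} refl = ≡ᵇ-refl m

  ≢⇒≡ᵇ-false : ∀ m n → ¬ m ≡ n → (m ≡ᵇ n) ≡ false
  ≢⇒≡ᵇ-false m n ne with m ≡ᵇ n in eq
  ... | true = ⊥-elim (ne (≡ᵇ≡true⇒≡ m n eq))
  ... | false = refl

  t≢f : ¬ true ≡ false
  t≢f ()

  ∧-intro : ∀ {a b} → a ≡ true → b ≡ true → a ∧ b ≡ true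
  ∧-intro refl refl = refl
  ∨-elim : ∀ {a b} → a ∨ b ≡ true → (a ≡ true) ⊎ (b ≡ true)
  ∨-elim {true} p = inj₁ refl
  ∨-elim {false} p = inj₂ p
  ∨-introˡ : ∀ {a b} → a ≡ true → a ∨ b ≡ true
  ∨-introˡ refl = refl
  ∨-introʳ : ∀ {a b} → b ≡ true → a ∨ b ≡ true
  ∨-introʳ {true} p = refl
  ∨-introʳ {false} p = p
  not-true : ∀ {a} → not a ≡ true → a ≡ false
  not-true {false} p = refl
  not-true {true} ()
  not-false : ∀ {a} → a ≡ false → not a ≡ true
  not-false refl = refl

  bool-ext : ∀ {a b} → (a ≡ true → b ≡ true) → (b ≡ true → a ≡ true) → a ≡ b
  bool-ext {true} {true} f g = refl
  bool-ext {true} {false} f g = sym (f refl)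
  bool-ext {false} {true} f g = g refl
  bool-ext {false} {false} f g = refl

  any-∈ : ∀ {A : Set} (p : A → Bool) xs → any p xs ≡ true → ∃ λ x → x ∈ xs × p x ≡ true
  any-∈ p (x ∷ xs) e with p x in px
  ... | true = x , here refl , px
  ... | false with any-∈ p xs e
  ... | y , m , q = y , there m , q
  any-∈ p [] ()

  ∈-any : ∀ {A : Set} (p : A → Bool) {xs x} → x ∈ xs → p x ≡ true → any p xs ≡ true
  ∈-any p (here refl) q rewrite q = refl
  ∈-any p {y ∷ xs} (there m) q = ∨-introʳ {p y} (∈-any p m q)

  all-∈ : ∀ {A : Set} (p : A → Bool) {xs x} → all p xs ≡ true → x ∈ xs → p x ≡ true
  all-∈ p {y ∷ xs} e (here refl) = ∧-conicalˡ _ _ e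
  all-∈ p {y ∷ xs} e (there m) = all-∈ p (∧-conicalʳ (p y) _ e) m

  ∈-all : ∀ {A : Set} (p : A → Bool) xs → (∀ x → x ∈ xs → p x ≡ true) → all p xs ≡ true
  ∈-all p [] f = refl
  ∈-all p (x ∷ xs) f = ∧-intro (f x (here refl)) (∈-all p xs (λ y m → f y (there m)))

  any-false : ∀ {A : Set} (p : A → Bool) xs → (∀ x → x ∈ xs → p x ≡ false) → any p xs ≡ false
  any-false p xs f = ¬-not λ e → let (x , m , q) = any-∈ p xs e in t≢f (trans (sym q) (f x m))

  any-cong : ∀ {A : Set} (p q : A → Bool) xs → (∀ x → x ∈ xs → p x ≡ q x) → any p xs ≡ any q xs
  any-cong p q [] f = refl
  any-cong p q (x ∷ xs) f = cong₂ _∨_ (f x (here refl)) (any-cong p q xs (λ y m → f y (there m)))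

  all-cong : ∀ {A : Set} (p q : A → Bool) xs → (∀ x → x ∈ xs → p x ≡ q x) → all p xs ≡ all q xs
  all-cong p q [] f = refl
  all-cong p q (x ∷ xs) f = cong₂ _∧_ (f x (here refl)) (all-cong p q xs (λ y m → f y (there m)))

  elemᵇ-∈ : ∀ v xs → elemᵇ v xs ≡ true → v ∈ xs
  elemᵇ-∈ v xs e with any-∈ (λ x → x ≡ᵇ v) xs e
  ... | x , m , q rewrite ≡ᵇ≡true⇒≡ x v q = m

  ∈-elemᵇ : ∀ {v xs} → v ∈ xs → elemᵇ v xs ≡ true
  ∈-elemᵇ {v} m = ∈-any (λ x → x ≡ᵇ v) m (≡ᵇ-refl v)

  ∉-elemᵇ : ∀ {v xs} → ¬ v ∈ xs → elemᵇ v xs ≡ false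
  ∉-elemᵇ {v} {xs} n = ¬-not λ e → n (elemᵇ-∈ v xs e)

  filterᵇ-∷ : ∀ {A : Set} (p : A → Bool) x xs → filterᵇ p (x ∷ xs) ≡ (if p x then x ∷ filterᵇ p xs else filterᵇ p xs)
  filterᵇ-∷ p x xs with p x
  ... | true = refl
  ... | false = refl

  ∈-filter⁻ : ∀ {A : Set} (p : A → Bool) {x} xs → x ∈ filterᵇ p xs → x ∈ xs × p x ≡ true
  ∈-filter⁻ p [] ()
  ∈-filter⁻ p (y ∷ xs) m rewrite filterᵇ-∷ p y xs with p y in py
  ∈-filter⁻ p (y ∷ xs) (here refl) | true = here refl , py
  ∈-filter⁻ p (y ∷ xs) (there m) | true = let (a , b) = ∈-filter⁻ p xs m in there a , b
  ∈-filter⁻ p (y ∷ xs) m | false = let (a , b) = ∈-filter⁻ p xs m in there a , b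

  ∈-filter⁺ : ∀ {A : Set} (p : A → Bool) {x} xs → x ∈ xs → p x ≡ true → x ∈ filterᵇ p xs
  ∈-filter⁺ p (y ∷ xs) m q rewrite filterᵇ-∷ p y xs with p y in py
  ∈-filter⁺ p (y ∷ xs) (here refl) q | true = here refl
  ∈-filter⁺ p (y ∷ xs) (there m) q | true = there (∈-filter⁺ p xs m q)
  ∈-filter⁺ p (y ∷ xs) (here refl) q | false = ⊥-elim (t≢f (trans (sym q) py))
  ∈-filter⁺ p (y ∷ xs) (there m) q | false = ∈-filter⁺ p xs m q

  filter-cong : ∀ {A : Set} (p q : A → Bool) xs → (∀ x → x ∈ xs → p x ≡ q x) → filterᵇ p xs ≡ filterᵇ q xs
  filter-cong p q [] f = refl
  filter-cong p q (x ∷ xs) f rewrite filterᵇ-∷ p x xs | filterᵇ-∷ q x xs | f x (here refl)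
    | filter-cong p q xs (λ y m → f y (there m)) = refl

  filter-map : ∀ {A B : Set} (p : B → Bool) (f : A → B) xs → filterᵇ p (map f xs) ≡ map f (filterᵇ (p ∘ f) xs)
  filter-map p f [] = refl
  filter-map p f (x ∷ xs) rewrite filterᵇ-∷ p (f x) (map f xs) | filterᵇ-∷ (p ∘ f) x xs with p (f x)
  ... | true = cong (f x ∷_) (filter-map p f xs)
  ... | false = filter-map p f xs

  filter-filter : ∀ {A : Set} (p q : A → Bool) xs → filterᵇ p (filterᵇ q xs) ≡ filterᵇ (λ x → q x ∧ p x) xs
  filter-filter p q [] = refl
  filter-filter p q (x ∷ xs) rewrite filterᵇ-∷ q x xs | filterᵇ-∷ (λ x → q x ∧ p x) x xs with q x
  ... | true rewrite filterᵇ-∷ p x (filterᵇ q xs) with p x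
  ...   | true = cong (x ∷_) (filter-filter p q xs)
  ...   | false = filter-filter p q xs
  filter-filter p q (x ∷ xs) | false = filter-filter p q xs

  length-filter-not : ∀ {A : Set} (p : A → Bool) xs → length (filterᵇ p xs) + length (filterᵇ (not ∘ p) xs) ≡ length xs
  length-filter-not p [] = refl
  length-filter-not p (x ∷ xs) rewrite filterᵇ-∷ p x xs | filterᵇ-∷ (not ∘ p) x xs with p x
  ... | true = cong suc (length-filter-not p xs)
  ... | false = trans (+-suc _ _) (cong suc (length-filter-not p xs))

  upTo-suc : ∀ n → upTo (suc n) ≡ 0 ∷ map suc (upTo n)
  upTo-suc n = cong (0 ∷_) (sym (map-applyUpTo id suc n))

  at-∈ : ∀ xs {i} → i < length xs → at xs i ∈ xs
  at-∈ (x ∷ xs) {zero} p = here refl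
  at-∈ (x ∷ xs) {suc i} (s≤s p) = there (at-∈ xs p)

  at-map : ∀ (f : ℕ → ℕ) xs {i} → i < length xs → at (map f xs) i ≡ f (at xs i)
  at-map f (x ∷ xs) {zero} p = refl
  at-map f (x ∷ xs) {suc i} (s≤s p) = at-map f xs p

  indexOf-< : ∀ {v} xs → v ∈ xs → indexOf v xs < length xs
  indexOf-< {v} (x ∷ xs) m with x ≡ᵇ v in eq
  ... | true = s≤s z≤n
  ... | false with m
  ...   | here refl = ⊥-elim (t≢f (trans (sym (≡ᵇ-refl v)) eq))
  ...   | there m' = s≤s (indexOf-< xs m')

  at-indexOf : ∀ {v} xs → v ∈ xs → at xs (indexOf v xs) ≡ v
  at-indexOf {v} (x ∷ xs) m with x ≡ᵇ v in eq
  ... | true = ≡ᵇ≡true⇒≡ x v eq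
  ... | false with m
  ...   | here refl = ⊥-elim (t≢f (trans (sym (≡ᵇ-refl v)) eq))
  ...   | there m' = at-indexOf xs m'

  Sorted : List ℕ → Set
  Sorted = AllPairs _<_

  indexOf-at : ∀ xs → Sorted xs → ∀ {r} → r < length xs → indexOf (at xs r) xs ≡ r
  indexOf-at (x ∷ xs) (a ∷ s) {zero} p rewrite ≡ᵇ-refl x = refl
  indexOf-at (x ∷ xs) (a ∷ s) {suc r} (s≤s p)
    rewrite ≢⇒≡ᵇ-false x (at xs r) (λ e → <-irrefl e (AllM.lookup a (at-∈ xs p))) = cong suc (indexOf-at xs s p)

  at-mono : ∀ xs → Sorted xs → ∀ {r s} → r < s → s < length xs → at xs r < at xs s
  at-mono (x ∷ xs) (a ∷ srt) {zero} {suc s} r<s (s≤s p) = AllM.lookup a (at-∈ xs p)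
  at-mono (x ∷ xs) (a ∷ srt) {suc r} {suc s} (s≤s r<s) (s≤s p) = at-mono xs srt r<s p

  map-cong-∈ : ∀ {A B : Set} (f g : A → B) xs → (∀ x → x ∈ xs → f x ≡ g x) → map f xs ≡ map g xs
  map-cong-∈ f g [] h = refl
  map-cong-∈ f g (x ∷ xs) h = cong₂ _∷_ (h x (here refl)) (map-cong-∈ f g xs (λ y m → h y (there m)))

  map-indexOf : ∀ xs → Sorted xs → map (λ i → indexOf i xs) xs ≡ upTo (length xs)
  map-indexOf [] s = refl
  map-indexOf (x ∷ xs) (a ∷ srt) rewrite ≡ᵇ-refl x | upTo-suc (length xs) = cong (0 ∷_) (
    trans (map-cong-∈ _ (suc ∘ (λ i → indexOf i xs)) xs
            (λ y m → cong (λ b → if b then 0 else suc (indexOf y xs))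
                          (≢⇒≡ᵇ-false x y (λ e → <-irrefl e (AllM.lookup a m)))))
          (trans (map-∘ {g = suc} {f = λ i → indexOf i xs} xs) (cong (map suc) (map-indexOf xs srt))))

  indexOf-map-inj : ∀ (g : ℕ → ℕ) (U : List ℕ) → (∀ a b → a ∈ U → b ∈ U → g a ≡ g b → a ≡ b) →
    ∀ y p → y ∈ U → (∀ x → x ∈ p → x ∈ U) → indexOf (g y) (map g p) ≡ indexOf y p
  indexOf-map-inj g U inj y [] yU pU = refl
  indexOf-map-inj g U inj y (x ∷ p) yU pU
    rewrite bool-ext {g x ≡ᵇ g y} {x ≡ᵇ y} (λ e → ≡⇒≡ᵇ≡true (inj x y (pU x (here refl)) yU (≡ᵇ≡true⇒≡ _ _ e)))
                                          (λ e → ≡⇒≡ᵇ≡true (cong g (≡ᵇ≡true⇒≡ _ _ e)))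
    = cong (λ r → if x ≡ᵇ y then 0 else suc r) (indexOf-map-inj g U inj y p yU (λ z m → pU z (there m)))

  upTo-sorted : ∀ n → Sorted (upTo n)
  upTo-sorted n = applyUpTo⁺₁ id n (λ i<j _ → i<j)

  filter-sorted : ∀ (p : ℕ → Bool) xs → Sorted xs → Sorted (filterᵇ p xs)
  filter-sorted p xs s = filter⁺ (T? ∘ p) s

  all-map : ∀ {A B : Set} (g : B → Bool) (h : A → B) xs → all g (map h xs) ≡ all (g ∘ h) xs
  all-map g h [] = refl
  all-map g h (x ∷ xs) = cong (g (h x) ∧_) (all-map g h xs)

  ≡ᵇ-sym : ∀ m n → (m ≡ᵇ n) ≡ (n ≡ᵇ m)
  ≡ᵇ-sym zero zero = refl
  ≡ᵇ-sym zero (suc n) = refl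
  ≡ᵇ-sym (suc m) zero = refl
  ≡ᵇ-sym (suc m) (suc n) = ≡ᵇ-sym m n


module Cycles where

  open import Data.List.Relation.Unary.AllPairs using ([]; _∷_)
  open Basics
  open import Data.Nat using (_+_; _*_; _∸_)
  open import Data.Nat.Properties
  open import Data.Nat.DivMod using (_%_; _/_; m≡m%n+[m/n]*n; m%n<n)
  open import Data.List.Relation.Binary.Permutation.Propositional using (_↭_; ↭-sym)
  open import Data.List.Relation.Binary.Permutation.Propositional.Properties using (∈-resp-↭)
  open import Data.Fin as F using (Fin; toℕ; fromℕ<)
  open import Data.Fin.Properties using (pigeonhole; toℕ-fromℕ<; toℕ<n)
  open import Relation.Binary.PropositionalEquality
  open import Relation.Binary.Definitions using (tri<; tri≈; tri>)

  IsPermMap : List ℕ → Set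
  IsPermMap σ = (∀ i → i < length σ → at σ i < length σ) ×
           (∀ i j → i < length σ → j < length σ → at σ i ≡ at σ j → i ≡ j)

  at-inj : ∀ xs → AllPairs (λ a b → ¬ a ≡ b) xs → ∀ i j → i < length xs → j < length xs → at xs i ≡ at xs j → i ≡ j
  at-inj (x ∷ xs) (a ∷ u) zero zero p q e = refl
  at-inj (x ∷ xs) (a ∷ u) zero (suc j) p (s≤s q) e = ⊥-elim (AllM.lookup a (at-∈ xs q) e)
  at-inj (x ∷ xs) (a ∷ u) (suc i) zero (s≤s p) q e = ⊥-elim (AllM.lookup a (at-∈ xs p) (sym e))
  at-inj (x ∷ xs) (a ∷ u) (suc i) (suc j) (s≤s p) (s≤s q) e = cong suc (at-inj xs u i j p q e)

  IsPerm⇒IsPermMap : ∀ σ → IsPerm σ → IsPermMap σ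
  IsPerm⇒IsPermMap σ P = (λ i i<n → ∈-upTo⁻ (∈-resp-↭ P (at-∈ σ i<n))) ,
                  at-inj σ uniq
    where
    open import Data.List.Relation.Binary.Permutation.Propositional using (↭⇒↭ₛ)
    import Data.List.Relation.Binary.Permutation.Setoid.Properties as PermSetoid
    import Data.List.Relation.Unary.Unique.Propositional.Properties as UP
    uniq : AllPairs (λ a b → ¬ a ≡ b) σ
    uniq = PermSetoid.Unique-resp-↭ (setoid ℕ) (↭⇒↭ₛ (↭-sym P)) (UP.upTo⁺ (length σ))

  module _ (σ : List ℕ) (G : IsPermMap σ) where
    private
      n = length σ
      f = at σ
      f< = proj₁ G
      finj = proj₂ G

    pow-< : ∀ k {i} → i < n → pow σ k i < n
    pow-< zero p = p
    pow-< (suc k) p = f< _ (pow-< k p)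

    Reach : ℕ → ℕ → Set
    Reach i j = ∃ λ k → pow σ k i ≡ j

    pow-cancel : ∀ a b {i} → i < n → pow σ a i ≡ pow σ (a + b) i → i ≡ pow σ b i
    pow-cancel zero b p e = e
    pow-cancel (suc a) b p e = pow-cancel a b p (finj _ _ (pow-< a p) (pow-< (a + b) p) e)

    pow-period : ∀ {i} → i < n → ∃ λ p → suc p ≤ n × pow σ (suc p) i ≡ i
    pow-period {i} i<n with pigeonhole (n<1+n n) (λ k → fromℕ< (pow-< (toℕ k) i<n))
    ... | a , b , a<b , e =
        let ea = toℕ-fromℕ< (pow-< (toℕ a) i<n)
            eb = toℕ-fromℕ< (pow-< (toℕ b) i<n)
            e' : pow σ (toℕ a) i ≡ pow σ (toℕ b) i
            e' = trans (sym ea) (trans (cong toℕ e) eb)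
            d = toℕ b ∸ toℕ a
            bd : toℕ a + d ≡ toℕ b
            bd = m+[n∸m]≡n (<⇒≤ a<b)
            d>0 : 0 < d
            d>0 = m<n⇒0<n∸m a<b
            sd : suc (ℕ.pred d) ≡ d
            sd = suc-pred d {{ℕ.>-nonZero d>0}}
            bnd : suc (ℕ.pred d) ≤ n
            bnd = subst (_≤ n) (sym sd) (≤-trans (m∸n≤m (toℕ b) (toℕ a)) (≤-pred (toℕ<n b)))
        in ℕ.pred d , bnd , sym (trans (pow-cancel (toℕ a) d i<n (trans e' (cong (λ z → pow σ z i) (sym bd))))
                              (cong (λ z → pow σ z i) (sym sd)))

    pow-+ : ∀ a b i → pow σ (a + b) i ≡ pow σ a (pow σ b i)
    pow-+ zero b i = refl
    pow-+ (suc a) b i = cong f (pow-+ a b i)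

    pow-mult : ∀ p q {i} → pow σ p i ≡ i → pow σ (q * p) i ≡ i
    pow-mult p zero e = refl
    pow-mult p (suc q) {i} e = trans (pow-+ p (q * p) i) (trans (cong (pow σ p) (pow-mult p q e)) e)

    pow-reduce : ∀ {i} → i < n → ∀ k → ∃ λ r → r < n × pow σ r i ≡ pow σ k i
    pow-reduce {i} i<n k with pow-period i<n
    ... | p , ple , e = k % suc p , <-≤-trans (m%n<n k (suc p)) ple ,
          sym (trans (cong (λ z → pow σ z i) (m≡m%n+[m/n]*n k (suc p)))
              (trans (pow-+ (k % suc p) ((k / suc p) * suc p) i) (cong (pow σ (k % suc p)) (pow-mult (suc p) (k / suc p) e))))

    R-refl : ∀ i → Reach i i
    R-refl i = 0 , refl

    R-trans : ∀ {i j k} → Reach i j → Reach j k → Reach i k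
    R-trans {i} (a , refl) (b , refl) = b + a , pow-+ b a i

    R-step : ∀ i → Reach i (f i)
    R-step i = 1 , refl

    R-< : ∀ {i j} → i < n → Reach i j → j < n
    R-< p (k , refl) = pow-< k p

    R-sym : ∀ {i j} → i < n → Reach i j → Reach j i
    R-sym {i} i<n (k , refl) with pow-period i<n
    ... | p , _ , e = (k * suc p ∸ k) ,
          trans (sym (pow-+ (k * suc p ∸ k) k i))
                (trans (cong (λ z → pow σ z i) (m∸n+n≡m (m≤m*n k (suc p))))
                       (trans (cong (λ z → pow σ z i) (*-comm k (suc p))) (pow-mult' (suc p) k e)))
      where
      pow-mult' : ∀ p q → pow σ p i ≡ i → pow σ (p * q) i ≡ i
      pow-mult' p q e = trans (cong (λ z → pow σ z i) (*-comm p q)) (pow-mult p q e)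

    sameCycle⇒Reach : ∀ i j → sameCycle σ i j ≡ true → Reach i j
    sameCycle⇒Reach i j e with any-∈ (λ k → pow σ k i ≡ᵇ j) (upTo n) e
    ... | k , _ , q = k , ≡ᵇ≡true⇒≡ _ _ q

    Reach⇒sameCycle : ∀ {i j} → i < n → Reach i j → sameCycle σ i j ≡ true
    Reach⇒sameCycle {i} {j} i<n (k , e) with pow-reduce i<n k
    ... | r , r<n , e' = ∈-any (λ k → pow σ k i ≡ᵇ j) (∈-upTo⁺ r<n) (≡⇒≡ᵇ≡true (trans e' e))

    isLeader⇒unreachable : ∀ L → L < n → isLeader σ L ≡ true → ∀ j → j < L → ¬ Reach j L
    isLeader⇒unreachable L L<n e j j<L r = t≢f (trans (sym (∈-any (λ j → sameCycle σ j L) (∈-upTo⁺ j<L) (Reach⇒sameCycle (<-trans j<L L<n) r))) (not-true e))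

    unreachable⇒isLeader : ∀ L → (∀ j → j < L → ¬ Reach j L) → isLeader σ L ≡ true
    unreachable⇒isLeader L h = not-false (any-false (λ j → sameCycle σ j L) (upTo L) (λ j m → ¬-not (λ q → h j (∈-upTo⁻ m) (sameCycle⇒Reach j L q))))

    leader-exists-below : ∀ fuel i → i < fuel → i < n → ∃ λ L → L < n × isLeader σ L ≡ true × Reach L i
    leader-exists-below (suc fuel) i (s≤s i≤f) i<n with isLeader σ i in e
    ... | true = i , i<n , e , R-refl i
    ... | false with any-∈ (λ j → sameCycle σ j i) (upTo i) (trans (sym (not-involutive _)) (cong not e))
    ...   | j , m , q with leader-exists-below fuel j (<-≤-trans (∈-upTo⁻ m) i≤f) (<-trans (∈-upTo⁻ m) i<n)
    ...     | L , L<n , lL , r = L , L<n , lL , R-trans r (sameCycle⇒Reach j i q)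

    leader-exists : ∀ i → i < n → ∃ λ L → L < n × isLeader σ L ≡ true × Reach L i
    leader-exists i i<n = leader-exists-below (suc i) i ≤-refl i<n

    leader-unique : ∀ L₁ L₂ i → L₁ < n → L₂ < n → isLeader σ L₁ ≡ true → isLeader σ L₂ ≡ true →
                  Reach L₁ i → Reach L₂ i → L₁ ≡ L₂
    leader-unique L₁ L₂ i p₁ p₂ l₁ l₂ r₁ r₂ with <-cmp L₁ L₂
    ... | tri≈ _ e _ = e
    ... | tri< a _ _ = ⊥-elim (isLeader⇒unreachable L₂ p₂ l₂ L₁ a (R-trans r₁ (R-sym p₂ r₂)))
    ... | tri> _ _ c = ⊥-elim (isLeader⇒unreachable L₁ p₁ l₁ L₂ c (R-trans r₂ (R-sym p₁ r₁)))

    orbit⁻ : ∀ L i → i ∈ orbit σ L → i < n × Reach L i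
    orbit⁻ L i m = let (a , b) = ∈-filter⁻ (sameCycle σ L) (upTo n) m in ∈-upTo⁻ a , sameCycle⇒Reach L i b

    orbit⁺ : ∀ L i → L < n → Reach L i → i ∈ orbit σ L
    orbit⁺ L i L<n r = ∈-filter⁺ (sameCycle σ L) (upTo n) (∈-upTo⁺ (R-< L<n r)) (Reach⇒sameCycle L<n r)

    cycles⁻ : ∀ c → c ∈ cycles σ → ∃ λ L → L < n × isLeader σ L ≡ true × c ≡ orbit σ L
    cycles⁻ c m with ∈-map⁻ (orbit σ) m
    ... | L , mL , refl = let (a , b) = ∈-filter⁻ (isLeader σ) (upTo n) mL in L , ∈-upTo⁻ a , b , refl

    cycles⁺ : ∀ L → L < n → isLeader σ L ≡ true → orbit σ L ∈ cycles σ
    cycles⁺ L L<n l = ∈-map⁺ (orbit σ) (∈-filter⁺ (isLeader σ) (upTo n) (∈-upTo⁺ L<n) l)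

  inUnion : List (List ℕ) → ℕ → Bool
  inUnion S i = any (elemᵇ i) S

  Disjoint : List (List ℕ) → Set
  Disjoint [] = Data.Unit.⊤ where import Data.Unit
  Disjoint (c ∷ cs) = (∀ i → i ∈ c → inUnion cs i ≡ false) × Disjoint cs

  AllPairs-from-< : ∀ {R : ℕ → ℕ → Set} ls → Sorted ls → (∀ a b → a ∈ ls → b ∈ ls → a < b → R a b) → AllPairs R ls
  AllPairs-from-< [] s h = []
  AllPairs-from-< (x ∷ xs) (a ∷ s) h =
    AllM.tabulate (λ {y} m → h x y (here refl) (there m) (AllM.lookup a m)) ∷
    AllPairs-from-< xs s (λ a b ma mb → h a b (there ma) (there mb))

  Disjoint-map : ∀ (g : ℕ → List ℕ) ls → AllPairs (λ a b → ∀ i → i ∈ g a → ¬ i ∈ g b) ls → Disjoint (map g ls)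
  Disjoint-map g [] _ = _
  Disjoint-map g (x ∷ xs) (a ∷ ap) =
    (λ i m → any-false (elemᵇ i) (map g xs) (λ c mc → let (y , my , e) = ∈-map⁻ g mc in
         subst (λ c → elemᵇ i c ≡ false) (sym e) (∉-elemᵇ (AllM.lookup a my i m)))) ,
    Disjoint-map g xs ap

  module _ (σ : List ℕ) (G : IsPermMap σ) where
    private
      n = length σ
      f = at σ

    leaders = filterᵇ (isLeader σ) (upTo n)

    cycles-disjoint : Disjoint (cycles σ)
    cycles-disjoint = Disjoint-map (orbit σ) leaders
      (AllPairs-from-< leaders (filter-sorted (isLeader σ) (upTo n) (upTo-sorted n))
        λ a b ma mb a<b i ia ib →
          let (ma1 , la) = ∈-filter⁻ (isLeader σ) (upTo n) ma
              (mb1 , lb) = ∈-filter⁻ (isLeader σ) (upTo n) mb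
          in <-irrefl (leader-unique σ G a b i (∈-upTo⁻ ma1) (∈-upTo⁻ mb1) la lb
                          (proj₂ (orbit⁻ σ G a i ia)) (proj₂ (orbit⁻ σ G b i ib))) a<b)

    cycles-cover : ∀ i → i < n → inUnion (cycles σ) i ≡ true
    cycles-cover i i<n with leader-exists σ G i i<n
    ... | L , L<n , l , r = ∈-any (elemᵇ i) (cycles⁺ σ G L L<n l) (∈-elemᵇ (orbit⁺ σ G L i L<n r))

    cycle-bounded : ∀ c i → c ∈ cycles σ → i ∈ c → i < n
    cycle-bounded c i mc mi with cycles⁻ σ G c mc
    ... | L , L<n , l , refl = proj₁ (orbit⁻ σ G L i mi)

    cycle-nonempty : ∀ c → c ∈ cycles σ → ∃ λ i → i ∈ c
    cycle-nonempty c mc with cycles⁻ σ G c mc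
    ... | L , L<n , l , refl = L , orbit⁺ σ G L L L<n (R-refl σ G L)

    cycle-closed : ∀ c i → c ∈ cycles σ → i < n → elemᵇ i c ≡ elemᵇ (f i) c
    cycle-closed c i mc i<n with cycles⁻ σ G c mc
    ... | L , L<n , l , refl = bool-ext
          (λ e → ∈-elemᵇ (orbit⁺ σ G L (f i) L<n (R-trans σ G (proj₂ (orbit⁻ σ G L i (elemᵇ-∈ _ _ e))) (R-step σ G i))))
          (λ e → ∈-elemᵇ (orbit⁺ σ G L i L<n (R-trans σ G (proj₂ (orbit⁻ σ G L (f i) (elemᵇ-∈ _ _ e)))
                                               (R-sym σ G i<n (R-step σ G i)))))


module Restriction where

  open Basics
  open Cycles
  open import Data.Nat using (_+_; _*_; _∸_)
  open import Data.Nat.Properties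
  open import Relation.Binary.PropositionalEquality
  open import Relation.Binary.Definitions using (tri<; tri≈; tri>)

  -- restrictTo σ S is definitionally restrictBy σ (inUnion S).
  restrictBy : List ℕ → (ℕ → Bool) → List ℕ
  restrictBy σ P = map (λ u → indexOf (at σ u) (filterᵇ P (upTo (length σ)))) (filterᵇ P (upTo (length σ)))

  restrictBy-cong : ∀ σ P Q → (∀ i → i < length σ → P i ≡ Q i) → restrictBy σ P ≡ restrictBy σ Q
  restrictBy-cong σ P Q h rewrite filter-cong P Q (upTo (length σ)) (λ i m → h i (∈-upTo⁻ m)) = refl

  Closed : List ℕ → (ℕ → Bool) → Set
  Closed σ P = ∀ i → i < length σ → P i ≡ P (at σ i)

  module Restricted (σ : List ℕ) (G : IsPermMap σ) (P : ℕ → Bool) (C : Closed σ P) where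
    n = length σ
    f = at σ
    U = filterᵇ P (upTo n)
    idx : ℕ → ℕ
    idx i = indexOf i U
    m = length U
    σP = restrictBy σ P

    U-sorted : Sorted U
    U-sorted = filter-sorted P (upTo n) (upTo-sorted n)

    U⁻ : ∀ {i} → i ∈ U → i < n × P i ≡ true
    U⁻ mi = let (a , b) = ∈-filter⁻ P (upTo n) mi in ∈-upTo⁻ a , b

    U⁺ : ∀ {i} → i < n → P i ≡ true → i ∈ U
    U⁺ i<n p = ∈-filter⁺ P (upTo n) (∈-upTo⁺ i<n) p

    len-σP : length σP ≡ m
    len-σP = length-map _ U

    σP-at : ∀ r → r < m → at σP r ≡ idx (f (at U r))
    σP-at r r<m = at-map (λ u → idx (f u)) U r<m

    σP-at' : ∀ {i} → i ∈ U → at σP (idx i) ≡ idx (f i)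
    σP-at' {i} mi = trans (σP-at (idx i) (indexOf-< U mi)) (cong (idx ∘ f) (at-indexOf U mi))

    idx-at : ∀ {r} → r < m → idx (at U r) ≡ r
    idx-at = indexOf-at U U-sorted

    at-idx : ∀ {i} → i ∈ U → at U (idx i) ≡ i
    at-idx = at-indexOf U

    idx< : ∀ {i} → i ∈ U → idx i < m
    idx< = indexOf-< U

    atU∈ : ∀ {r} → r < m → at U r ∈ U
    atU∈ = at-∈ U

    f∈U : ∀ {i} → i ∈ U → f i ∈ U
    f∈U mi = let (a , b) = U⁻ mi in U⁺ (proj₁ G _ a) (trans (sym (C _ a)) b)

    pow∈U : ∀ k {i} → i ∈ U → pow σ k i ∈ U
    pow∈U zero mi = mi
    pow∈U (suc k) mi = f∈U (pow∈U k mi)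

    Closed-Reach : ∀ {i j} → i < n → Reach σ G i j → P i ≡ P j
    Closed-Reach {i} i<n (zero , refl) = refl
    Closed-Reach {i} i<n (suc k , refl) = trans (Closed-Reach i<n (k , refl)) (C _ (pow-< σ G k i<n))

    idx-inj : ∀ {i j} → i ∈ U → j ∈ U → idx i ≡ idx j → i ≡ j
    idx-inj mi mj e = trans (sym (at-idx mi)) (trans (cong (at U) e) (at-idx mj))

    IsPermMap-restricted : IsPermMap σP
    IsPermMap-restricted = (λ r r<m' → let r<m = subst (r <_) len-σP r<m' in
               subst (_< length σP) (sym (σP-at r r<m)) (subst (idx (f (at U r)) <_) (sym len-σP) (idx< (f∈U (atU∈ r<m))))) ,
            λ r s r< s< e →
              let r<m = subst (r <_) len-σP r<
                  s<m = subst (s <_) len-σP s<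
                  e1 = trans (sym (σP-at r r<m)) (trans e (σP-at s s<m))
                  e2 = idx-inj (f∈U (atU∈ r<m)) (f∈U (atU∈ s<m)) e1
                  e3 = proj₂ G _ _ (proj₁ (U⁻ (atU∈ r<m))) (proj₁ (U⁻ (atU∈ s<m))) e2
              in trans (sym (idx-at r<m)) (trans (cong idx e3) (idx-at s<m))

    pow-restricted : ∀ k {i} → i ∈ U → pow σP k (idx i) ≡ idx (pow σ k i)
    pow-restricted zero mi = refl
    pow-restricted (suc k) {i} mi = trans (cong (at σP) (pow-restricted k mi)) (σP-at' (pow∈U k mi))

    Reach-restricted⁻ : ∀ {i j} → i ∈ U → j ∈ U → Reach σP IsPermMap-restricted (idx i) (idx j) → Reach σ G i j
    Reach-restricted⁻ mi mj (k , e) = k , idx-inj (pow∈U k mi) mj (trans (sym (pow-restricted k mi)) e)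

    Reach-restricted⁺ : ∀ {i j} → i ∈ U → Reach σ G i j → Reach σP IsPermMap-restricted (idx i) (idx j)
    Reach-restricted⁺ mi (k , refl) = k , pow-restricted k mi

    reach-U : ∀ {i j} → i ∈ U → Reach σ G i j → j ∈ U
    reach-U mi (k , refl) = pow∈U k mi

    idx-mono : ∀ {i j} → i ∈ U → j ∈ U → j < i → idx j < idx i
    idx-mono {i} {j} mi mj j<i with <-cmp (idx j) (idx i)
    ... | tri< a _ _ = a
    ... | tri≈ _ e _ = ⊥-elim (<-irrefl (idx-inj mj mi e) j<i)
    ... | tri> _ _ c = ⊥-elim (<-asym j<i (subst₂ _<_ (at-idx mi) (at-idx mj) (at-mono U U-sorted c (idx< mj))))

    m≡ : m ≡ length σP
    m≡ = sym len-σP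

    idx<P : ∀ {i} → i ∈ U → idx i < length σP
    idx<P {i} mi = subst (idx i <_) m≡ (idx< mi)

    sameCycle-restricted : ∀ {i j} → i ∈ U → j ∈ U → sameCycle σP (idx i) (idx j) ≡ sameCycle σ i j
    sameCycle-restricted mi mj = bool-ext
      (λ e → Reach⇒sameCycle σ G (proj₁ (U⁻ mi)) (Reach-restricted⁻ mi mj (sameCycle⇒Reach σP IsPermMap-restricted _ _ e)))
      (λ e → Reach⇒sameCycle σP IsPermMap-restricted (idx<P mi) (Reach-restricted⁺ mi (sameCycle⇒Reach σ G _ _ e)))

    isLeader-restricted : ∀ {i} → i ∈ U → isLeader σP (idx i) ≡ isLeader σ i
    isLeader-restricted {i} mi = bool-ext
      (λ e → unreachable⇒isLeader σ G i (λ j j<i r →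
         let mj = U⁺ (<-trans j<i (proj₁ (U⁻ mi))) (trans (Closed-Reach (<-trans j<i (proj₁ (U⁻ mi))) r) (proj₂ (U⁻ mi)))
         in isLeader⇒unreachable σP IsPermMap-restricted (idx i) (idx<P mi) e (idx j) (idx-mono mi mj j<i) (Reach-restricted⁺ mj r)))
      (λ e → unreachable⇒isLeader σP IsPermMap-restricted (idx i) (λ s s<i r →
         let s<m = <-trans s<i (idx< mi)
             ms = atU∈ s<m
             r' = subst (λ z → Reach σP IsPermMap-restricted z (idx i)) (sym (idx-at s<m)) r
             lt : at U s < i
             lt = subst (at U s <_) (at-idx mi) (at-mono U U-sorted s<i (idx< mi))
         in isLeader⇒unreachable σ G i (proj₁ (U⁻ mi)) e (at U s) lt (Reach-restricted⁻ ms mi r')))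

    upTo-m : upTo (length σP) ≡ map idx U
    upTo-m = trans (cong upTo len-σP) (sym (map-indexOf U U-sorted))

    orbit-U : ∀ {i} → i ∈ U → orbit σ i ≡ filterᵇ (sameCycle σ i) U
    orbit-U {i} mi = sym (trans (filter-filter (sameCycle σ i) P (upTo n))
      (filter-cong _ _ (upTo n) λ x mx → lem x (∈-upTo⁻ mx)))
      where
      lem : ∀ x → x < n → P x ∧ sameCycle σ i x ≡ sameCycle σ i x
      lem x x<n with sameCycle σ i x in e
      ... | false = ∧-zeroʳ (P x)
      ... | true rewrite sym (Closed-Reach (proj₁ (U⁻ mi)) (sameCycle⇒Reach σ G i x e)) | proj₂ (U⁻ mi) = refl

    orbit-restricted : ∀ {i} → i ∈ U → orbit σP (idx i) ≡ map idx (orbit σ i)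
    orbit-restricted {i} mi = begin
        filterᵇ (sameCycle σP (idx i)) (upTo (length σP))
      ≡⟨ cong (filterᵇ (sameCycle σP (idx i))) upTo-m ⟩
        filterᵇ (sameCycle σP (idx i)) (map idx U)
      ≡⟨ filter-map _ idx U ⟩
        map idx (filterᵇ (sameCycle σP (idx i) ∘ idx) U)
      ≡⟨ cong (map idx) (filter-cong _ _ U (λ j mj → sameCycle-restricted mi mj)) ⟩
        map idx (filterᵇ (sameCycle σ i) U)
      ≡⟨ cong (map idx) (sym (orbit-U mi)) ⟩
        map idx (orbit σ i) ∎
      where open ≡-Reasoning

    LU = filterᵇ (isLeader σ) U

    LU⊆U : ∀ {L} → L ∈ LU → L ∈ U
    LU⊆U mL = proj₁ (∈-filter⁻ (isLeader σ) U mL)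

    cycles-restricted : cycles σP ≡ map (λ L → map idx (orbit σ L)) LU
    cycles-restricted = begin
        map (orbit σP) (filterᵇ (isLeader σP) (upTo (length σP)))
      ≡⟨ cong (λ z → map (orbit σP) (filterᵇ (isLeader σP) z)) upTo-m ⟩
        map (orbit σP) (filterᵇ (isLeader σP) (map idx U))
      ≡⟨ cong (map (orbit σP)) (filter-map _ idx U) ⟩
        map (orbit σP) (map idx (filterᵇ (isLeader σP ∘ idx) U))
      ≡⟨ cong (λ z → map (orbit σP) (map idx z)) (filter-cong _ _ U (λ j mj → isLeader-restricted mj)) ⟩
        map (orbit σP) (map idx LU)
      ≡⟨ sym (map-∘ LU) ⟩
        map (orbit σP ∘ idx) LU
      ≡⟨ map-cong-∈ _ _ LU (λ L mL → orbit-restricted (LU⊆U mL)) ⟩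
        map (λ L → map idx (orbit σ L)) LU ∎
      where open ≡-Reasoning

    cycleWordFrom-cong : ∀ (γ₁ γ₂ : ℕ → ℕ) k → (∀ r → r < k → γ₁ r ≡ γ₂ r) → (∀ r → r < k → γ₂ r < k) →
               ∀ fuel r → r < k → cycleWordFrom γ₁ fuel r ≡ cycleWordFrom γ₂ fuel r
    cycleWordFrom-cong γ₁ γ₂ k h b zero r r<k = refl
    cycleWordFrom-cong γ₁ γ₂ k h b (suc fuel) r r<k rewrite h r r<k = cong (r ∷_) (cycleWordFrom-cong γ₁ γ₂ k h b fuel (γ₂ r) (b r r<k))

    module _ (L : ℕ) (mL : L ∈ LU) where
      p = orbit σ L
      mLU = LU⊆U mL
      L<n = proj₁ (U⁻ mLU)
      p⊆U : ∀ {x} → x ∈ p → x ∈ U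
      p⊆U mx = reach-U mLU (proj₂ (orbit⁻ σ G L _ mx))
      fp : ∀ {x} → x ∈ p → f x ∈ p
      fp {x} mx = orbit⁺ σ G L (f x) L<n (R-trans σ G (proj₂ (orbit⁻ σ G L x mx)) (R-step σ G x))
      k = length p

      relabel-restricted : ∀ r → r < k → relabel σP (map idx p) r ≡ relabel σ p r
      relabel-restricted r r<k = begin
          indexOf (at σP (at (map idx p) r)) (map idx p)
        ≡⟨ cong (λ z → indexOf (at σP z) (map idx p)) (at-map idx p r<k) ⟩
          indexOf (at σP (idx (at p r))) (map idx p)
        ≡⟨ cong (λ z → indexOf z (map idx p)) (σP-at' (p⊆U (at-∈ p r<k))) ⟩
          indexOf (idx (f (at p r))) (map idx p)
        ≡⟨ indexOf-map-inj idx U (λ a b ma mb e → idx-inj ma mb e) (f (at p r)) p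
             (f∈U (p⊆U (at-∈ p r<k))) (λ x mx → p⊆U mx) ⟩
          indexOf (f (at p r)) p ∎
        where open ≡-Reasoning

      relabel-< : ∀ r → r < k → relabel σ p r < k
      relabel-< r r<k = indexOf-< p (fp (at-∈ p r<k))

      cycleWords-restricted : cycleWords σP (map idx p) ≡ cycleWords σ p
      cycleWords-restricted rewrite length-map idx p =
        map-cong-∈ _ _ (upTo k) (λ r mr → cycleWordFrom-cong _ _ k relabel-restricted relabel-< k r (∈-upTo⁻ mr))

      cycleCondition-restricted : ∀ (au at' : List ℕ) → (∀ {i} → i ∈ U → at au (idx i) ≡ at at' i) →
             any (listEqᵇ (inv (Std (map (at au) (map idx p))))) (cycleWords σP (map idx p))
             ≡ any (listEqᵇ (inv (Std (map (at at') p)))) (cycleWords σ p)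
      cycleCondition-restricted au at' h rewrite cycleWords-restricted
        | sym (map-∘ {g = at au} {f = idx} p)
        | map-cong-∈ (at au ∘ idx) (at at') p (λ x mx → h (p⊆U mx)) = refl

    condII-restricted : ∀ (au at' : List ℕ) → (∀ {i} → i ∈ U → at au (idx i) ≡ at at' i) →
      condII σP au ≡ all (λ L → any (listEqᵇ (inv (Std (map (at at') (orbit σ L))))) (cycleWords σ (orbit σ L))) LU
    condII-restricted au at' h = begin
        all (λ p → any (listEqᵇ (inv (Std (map (at au) p)))) (cycleWords σP p)) (cycles σP)
      ≡⟨ cong (all _) cycles-restricted ⟩
        all (λ p → any (listEqᵇ (inv (Std (map (at au) p)))) (cycleWords σP p)) (map (λ L → map idx (orbit σ L)) LU)
      ≡⟨ all-map _ _ LU ⟩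
        all (λ L → any (listEqᵇ (inv (Std (map (at au) (map idx (orbit σ L)))))) (cycleWords σP (map idx (orbit σ L)))) LU
      ≡⟨ all-cong _ _ LU (λ L mL → cycleCondition-restricted L mL au at' h) ⟩
        _ ∎
      where open ≡-Reasoning

  xnor⇒≡ : ∀ a s → ((a ∧ s) ∨ (not a ∧ not s)) ≡ true → a ≡ s
  xnor⇒≡ true true e = refl
  xnor⇒≡ false false e = refl
  xnor⇒≡ true false ()
  xnor⇒≡ false true ()

  ≡⇒xnor : ∀ a s → a ≡ s → ((a ∧ s) ∨ (not a ∧ not s)) ≡ true
  ≡⇒xnor true true e = refl
  ≡⇒xnor false false e = refl

  condI-elim : ∀ σ x → condI σ x ≡ true → ∀ i j → i < length σ → j < length σ → (at x i ≡ᵇ at x j) ≡ sameCycle σ i j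
  condI-elim σ x e i j i< j< =
    xnor⇒≡ _ _ (all-∈ _ (all-∈ _ e (∈-upTo⁺ i<)) (∈-upTo⁺ j<))

  condI-intro : ∀ σ x → (∀ i j → i < length σ → j < length σ → (at x i ≡ᵇ at x j) ≡ sameCycle σ i j) → condI σ x ≡ true
  condI-intro σ x h = ∈-all _ _ (λ i mi → ∈-all _ _ (λ j mj → ≡⇒xnor _ _ (h i j (∈-upTo⁻ mi) (∈-upTo⁻ mj))))

  module RestrictedCondI (σ : List ℕ) (G : IsPermMap σ) (P : ℕ → Bool) (C : Closed σ P) where
    open Restricted σ G P C

    condI-restricted-elim : ∀ y → condI σP y ≡ true → ∀ {i j} → i ∈ U → j ∈ U → (at y (idx i) ≡ᵇ at y (idx j)) ≡ sameCycle σ i j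
    condI-restricted-elim y e mi mj = trans (condI-elim σP y e _ _ (idx<P mi) (idx<P mj)) (sameCycle-restricted mi mj)

    condI-restricted-intro : ∀ y → (∀ {i j} → i ∈ U → j ∈ U → (at y (idx i) ≡ᵇ at y (idx j)) ≡ sameCycle σ i j) → condI σP y ≡ true
    condI-restricted-intro y h = condI-intro σP y λ r s r< s< →
      let r<m = subst (r <_) len-σP r<
          s<m = subst (s <_) len-σP s<
          mi = atU∈ r<m
          mj = atU∈ s<m
      in subst₂ (λ a b → (at y a ≡ᵇ at y b) ≡ sameCycle σP a b) (idx-at r<m) (idx-at s<m)
           (trans (h mi mj) (sym (sameCycle-restricted mi mj)))


module Merging where

  open Basics
  open import Data.Nat using (_+_; _*_; _∸_)
  open import Data.Nat.Properties
  open import Relation.Binary.PropositionalEquality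

  bitAt : List Bool → ℕ → Bool
  bitAt [] _ = false
  bitAt (x ∷ b) zero = x
  bitAt (x ∷ b) (suc i) = bitAt b i

  trues : List Bool → ℕ
  trues [] = 0
  trues (true ∷ b) = suc (trues b)
  trues (false ∷ b) = trues b

  merge : ∀ {A : Set} → List Bool → List A → List A → List A
  merge [] u v = []
  merge (true ∷ b) (x ∷ u) v = x ∷ merge b u v
  merge (true ∷ b) [] v = []
  merge (false ∷ b) u (y ∷ v) = y ∷ merge b u v
  merge (false ∷ b) u [] = []

  truePositions : List Bool → List ℕ
  truePositions b = filterᵇ (bitAt b) (upTo (length b))

  truePositions-∷ : ∀ x b → truePositions (x ∷ b) ≡ (if x then 0 ∷ map suc (truePositions b) else map suc (truePositions b))
  truePositions-∷ x b = begin
      filterᵇ (bitAt (x ∷ b)) (upTo (suc (length b)))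
    ≡⟨ cong (filterᵇ (bitAt (x ∷ b))) (upTo-suc (length b)) ⟩
      filterᵇ (bitAt (x ∷ b)) (0 ∷ map suc (upTo (length b)))
    ≡⟨ filterᵇ-∷ (bitAt (x ∷ b)) 0 (map suc (upTo (length b))) ⟩
      (if x then 0 ∷ filterᵇ (bitAt (x ∷ b)) (map suc (upTo (length b))) else filterᵇ (bitAt (x ∷ b)) (map suc (upTo (length b))))
    ≡⟨ cong (λ z → if x then 0 ∷ z else z) (filter-map (bitAt (x ∷ b)) suc (upTo (length b))) ⟩
      (if x then 0 ∷ map suc (truePositions b) else map suc (truePositions b)) ∎
    where open ≡-Reasoning

  length-truePositions : ∀ b → length (truePositions b) ≡ trues b
  length-truePositions [] = refl
  length-truePositions (true ∷ b) = trans (cong length (truePositions-∷ true b)) (cong suc (trans (length-map suc (truePositions b)) (length-truePositions b)))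
  length-truePositions (false ∷ b) = trans (cong length (truePositions-∷ false b)) (trans (length-map suc (truePositions b)) (length-truePositions b))

  indexOf-suc : ∀ i U → indexOf (suc i) (map suc U) ≡ indexOf i U
  indexOf-suc i [] = refl
  indexOf-suc i (x ∷ U) = cong (λ r → if x ≡ᵇ i then 0 else suc r) (indexOf-suc i U)

  falses : List Bool → ℕ
  falses b = trues (map not b)

  length-merge : ∀ {A : Set} b (u v : List A) → trues b ≡ length u → falses b ≡ length v → length (merge b u v) ≡ length b
  length-merge [] u v e1 e2 = refl
  length-merge (true ∷ b) (x ∷ u) v e1 e2 = cong suc (length-merge b u v (suc-injective e1) e2)
  length-merge (false ∷ b) u (y ∷ v) e1 e2 = cong suc (length-merge b u v e1 (suc-injective e2))
  length-merge (true ∷ b) [] v () e2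
  length-merge (false ∷ b) u [] e1 ()

  map-merge : ∀ {A B : Set} (g : A → B) b u v → map g (merge b u v) ≡ merge b (map g u) (map g v)
  map-merge g [] u v = refl
  map-merge g (true ∷ b) (x ∷ u) v = cong (g x ∷_) (map-merge g b u v)
  map-merge g (true ∷ b) [] v = refl
  map-merge g (false ∷ b) u (y ∷ v) = cong (g y ∷_) (map-merge g b u v)
  map-merge g (false ∷ b) u [] = refl

  merge-not : ∀ {A : Set} b (u v : List A) → merge b u v ≡ merge (map not b) v u
  merge-not [] u v = refl
  merge-not (true ∷ b) (x ∷ u) v = cong (x ∷_) (merge-not b u v)
  merge-not (true ∷ b) [] v = refl
  merge-not (false ∷ b) u (y ∷ v) = cong (y ∷_) (merge-not b u v)
  merge-not (false ∷ b) u [] = refl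

  at-merge-true : ∀ b (u v : List ℕ) → trues b ≡ length u → falses b ≡ length v → ∀ i → i < length b → bitAt b i ≡ true →
    at (merge b u v) i ≡ at u (indexOf i (truePositions b))
  at-merge-true (true ∷ b) (x ∷ u) v e1 e2 zero p q = cong (λ z → at (x ∷ u) (indexOf 0 z)) (sym (truePositions-∷ true b))
  at-merge-true (true ∷ b) (x ∷ u) v e1 e2 (suc i) (s≤s p) q =
    trans (at-merge-true b u v (suc-injective e1) e2 i p q)
      (trans (cong (λ z → at (x ∷ u) (suc z)) (sym (indexOf-suc i (truePositions b))))
             (cong (λ z → at (x ∷ u) (indexOf (suc i) z)) (sym (truePositions-∷ true b))))
  at-merge-true (false ∷ b) u (y ∷ v) e1 e2 (suc i) (s≤s p) q =
    trans (at-merge-true b u v e1 (suc-injective e2) i p q)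
      (trans (cong (at u) (sym (indexOf-suc i (truePositions b))))
             (cong (λ z → at u (indexOf (suc i) z)) (sym (truePositions-∷ false b))))
  at-merge-true (false ∷ b) u (y ∷ v) e1 e2 zero p ()
  at-merge-true (true ∷ b) [] v () e2 i p q
  at-merge-true (false ∷ b) u [] e1 () i p q

  bitAt-map-not : ∀ b i → i < length b → bitAt (map not b) i ≡ not (bitAt b i)
  bitAt-map-not (x ∷ b) zero p = refl
  bitAt-map-not (x ∷ b) (suc i) (s≤s p) = bitAt-map-not b i p

  length-map-not : ∀ b → length (map not b) ≡ length b
  length-map-not b = length-map not b

  falses-map-not : ∀ b → falses (map not b) ≡ trues b
  falses-map-not [] = refl
  falses-map-not (true ∷ b) = cong suc (falses-map-not b)
  falses-map-not (false ∷ b) = falses-map-not b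

  at-merge-false : ∀ b (u v : List ℕ) → trues b ≡ length u → falses b ≡ length v → ∀ i → i < length b → bitAt b i ≡ false →
    at (merge b u v) i ≡ at v (indexOf i (truePositions (map not b)))
  at-merge-false b u v e1 e2 i p q = trans (cong (λ z → at z i) (merge-not b u v))
    (at-merge-true (map not b) v u e2 (trans (falses-map-not b) e1) i (subst (i <_) (sym (length-map-not b)) p)
      (trans (bitAt-map-not b i p) (cong not q)))

  trues+falses : ∀ b → trues b + falses b ≡ length b
  trues+falses [] = refl
  trues+falses (true ∷ b) = cong suc (trues+falses b)
  trues+falses (false ∷ b) = trans (+-suc (trues b) (falses b)) (cong suc (trues+falses b))

  length-restrictBy-bitAt : ∀ (σ : List ℕ) b → length b ≡ length σ →
    length (map (λ u → indexOf (at σ u) (filterᵇ (bitAt b) (upTo (length σ)))) (filterᵇ (bitAt b) (upTo (length σ)))) ≡ trues b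
  length-restrictBy-bitAt σ b lb = trans (length-map (λ u → indexOf (at σ u) (filterᵇ (bitAt b) (upTo (length σ)))) (filterᵇ (bitAt b) (upTo (length σ)))) (trans (cong (λ z → length (filterᵇ (bitAt b) (upTo z))) (sym lb)) (length-truePositions b))


module MergedTerms where

  open Basics
  open Cycles
  open Restriction
  open Merging
  open import Data.Nat using (_+_; _*_; _∸_)
  open import Data.Nat.Properties
  open import Relation.Binary.PropositionalEquality

  ≡ᵇ-injective : ∀ (g : ℕ → ℕ) → (∀ x y → g x ≡ g y → x ≡ y) → ∀ x y → (g x ≡ᵇ g y) ≡ (x ≡ᵇ y)
  ≡ᵇ-injective g inj x y = bool-ext (λ e → ≡⇒≡ᵇ≡true (inj x y (≡ᵇ≡true⇒≡ _ _ e))) (λ e → ≡⇒≡ᵇ≡true (cong g (≡ᵇ≡true⇒≡ _ _ e)))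

  all-partition : ∀ {A : Set} (g P : A → Bool) xs → all g xs ≡ all g (filterᵇ P xs) ∧ all g (filterᵇ (not ∘ P) xs)
  all-partition g P [] = refl
  all-partition g P (x ∷ xs) rewrite filterᵇ-∷ P x xs | filterᵇ-∷ (not ∘ P) x xs | all-partition g P xs with P x
  ... | true = sym (∧-assoc (g x) _ _)
  ... | false = trans (sym (∧-assoc (g x) _ _)) (trans (cong (_∧ all g (filterᵇ (not ∘ P) xs)) (∧-comm (g x) _)) (∧-assoc (all g (filterᵇ P xs)) (g x) _))

  constantOn : List Bool → List ℕ → Bool
  constantOn b c = all (bitAt b) c ∨ all (not ∘ bitAt b) c

  constantOnCycles : List ℕ → List Bool → Bool
  constantOnCycles σ b = all (constantOn b) (cycles σ)

  tag : (ℕ → ℕ) → ℕ × ℕ → ℕ × ℕ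
  tag g (x , a) = g x , a

  module MergedWord (σ : List ℕ) (G : IsPermMap σ) (f0 f1 : ℕ → ℕ)
    (inj0 : ∀ x y → f0 x ≡ f0 y → x ≡ y) (inj1 : ∀ x y → f1 x ≡ f1 y → x ≡ y) (disj : ∀ x y → ¬ f0 x ≡ f1 y)
    (b : List Bool) (lb : length b ≡ length σ) (u v : Monomial) (cu : trues b ≡ length u) (cv : falses b ≡ length v) where

    n = length σ
    f = at σ
    t = merge b (map (tag f0) u) (map (tag f1) v)
    Xu = map proj₁ u
    Xv = map proj₁ v
    Au = map proj₂ u
    Av = map proj₂ v
    Xt = map proj₁ t
    At = map proj₂ t
    P1 = bitAt b
    P2 = bitAt (map not b)

    Xt≡ : Xt ≡ merge b (map f0 Xu) (map f1 Xv)
    Xt≡ = trans (map-merge proj₁ b _ _)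
      (cong₂ (merge b) (trans (sym (map-∘ u)) (map-∘ u)) (trans (sym (map-∘ v)) (map-∘ v)))

    At≡ : At ≡ merge b Au Av
    At≡ = trans (map-merge proj₂ b _ _) (cong₂ (merge b) (sym (map-∘ u)) (sym (map-∘ v)))

    U1≡ : filterᵇ P1 (upTo n) ≡ truePositions b
    U1≡ = cong (λ z → filterᵇ P1 (upTo z)) (sym lb)

    U2≡ : filterᵇ P2 (upTo n) ≡ truePositions (map not b)
    U2≡ = cong (λ z → filterᵇ P2 (upTo z)) (sym (trans (length-map-not b) lb))

    i<b : ∀ {i} → i < n → i < length b
    i<b {i} p = subst (i <_) (sym lb) p

    cu' : ∀ (g : ℕ → ℕ) → trues b ≡ length (map g Xu)
    cu' g = trans cu (sym (trans (length-map g Xu) (length-map proj₁ u)))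
    cv' : ∀ (g : ℕ → ℕ) → falses b ≡ length (map g Xv)
    cv' g = trans cv (sym (trans (length-map g Xv) (length-map proj₁ v)))

    idx1 : ℕ → ℕ
    idx1 i = indexOf i (filterᵇ P1 (upTo n))
    idx2 : ℕ → ℕ
    idx2 i = indexOf i (filterᵇ P2 (upTo n))

    idx1< : ∀ {i} → i < n → P1 i ≡ true → idx1 i < length u
    idx1< {i} i<n q = subst (_< length u) (cong (indexOf i) (sym U1≡))
       (subst (indexOf i (truePositions b) <_) (trans (length-truePositions b) cu)
         (indexOf-< (truePositions b) (∈-filter⁺ P1 (upTo (length b)) (∈-upTo⁺ (i<b i<n)) q)))

    idx2< : ∀ {i} → i < n → P1 i ≡ false → idx2 i < length v
    idx2< {i} i<n q = subst (_< length v) (cong (indexOf i) (sym U2≡))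
       (subst (indexOf i (truePositions (map not b)) <_) (trans (length-truePositions (map not b)) cv)
         (indexOf-< (truePositions (map not b)) (∈-filter⁺ P2 (upTo (length (map not b)))
            (∈-upTo⁺ (subst (i <_) (sym (length-map-not b)) (i<b i<n))) (trans (bitAt-map-not b i (i<b i<n)) (cong not q)))))

    at-Xt1 : ∀ {i} → i < n → P1 i ≡ true → at Xt i ≡ f0 (at Xu (idx1 i))
    at-Xt1 {i} i<n q = trans (cong (λ z → at z i) Xt≡)
      (trans (at-merge-true b (map f0 Xu) (map f1 Xv) (cu' f0) (cv' f1) i (i<b i<n) q)
        (trans (cong (λ z → at (map f0 Xu) (indexOf i z)) (sym U1≡))
               (at-map f0 Xu (subst (idx1 i <_) (sym (length-map proj₁ u)) (idx1< i<n q)))))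

    at-Xt2 : ∀ {i} → i < n → P1 i ≡ false → at Xt i ≡ f1 (at Xv (idx2 i))
    at-Xt2 {i} i<n q = trans (cong (λ z → at z i) Xt≡)
      (trans (at-merge-false b (map f0 Xu) (map f1 Xv) (cu' f0) (cv' f1) i (i<b i<n) q)
        (trans (cong (λ z → at (map f1 Xv) (indexOf i z)) (sym U2≡))
               (at-map f1 Xv (subst (idx2 i <_) (sym (length-map proj₁ v)) (idx2< i<n q)))))

    at-At1 : ∀ {i} → i < n → P1 i ≡ true → at At i ≡ at Au (idx1 i)
    at-At1 {i} i<n q = trans (cong (λ z → at z i) At≡)
      (trans (at-merge-true b Au Av (trans cu (sym (length-map proj₂ u))) (trans cv (sym (length-map proj₂ v))) i (i<b i<n) q)
             (cong (λ z → at Au (indexOf i z)) (sym U1≡)))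

    at-At2 : ∀ {i} → i < n → P1 i ≡ false → at At i ≡ at Av (idx2 i)
    at-At2 {i} i<n q = trans (cong (λ z → at z i) At≡)
      (trans (at-merge-false b Au Av (trans cu (sym (length-map proj₂ u))) (trans cv (sym (length-map proj₂ v))) i (i<b i<n) q)
             (cong (λ z → at Av (indexOf i z)) (sym U2≡)))

    P2≡ : ∀ {i} → i < n → P2 i ≡ not (P1 i)
    P2≡ i<n = bitAt-map-not b _ (i<b i<n)

    constantOnCycles⇒Closed : constantOnCycles σ b ≡ true → Closed σ P1
    constantOnCycles⇒Closed e i i<n with any-∈ (elemᵇ i) (cycles σ) (cycles-cover σ G i i<n)
    ... | c , mc , ic with ∨-elim (all-∈ (constantOn b) e mc)
    ...   | inj₁ a = trans (all-∈ P1 a (elemᵇ-∈ i c ic))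
                       (sym (all-∈ P1 a (elemᵇ-∈ (f i) c (trans (sym (cycle-closed σ G c i mc i<n)) ic))))
    ...   | inj₂ a = trans (not-true (all-∈ (not ∘ P1) a (elemᵇ-∈ i c ic)))
                       (sym (not-true (all-∈ (not ∘ P1) a (elemᵇ-∈ (f i) c (trans (sym (cycle-closed σ G c i mc i<n)) ic)))))

    Closed⇒constantOnCycles : Closed σ P1 → constantOnCycles σ b ≡ true
    Closed⇒constantOnCycles C = ∈-all (constantOn b) (cycles σ) λ c mc → lem c mc
      where
      open Restricted σ G P1 C using (Closed-Reach)
      lem : ∀ c → c ∈ cycles σ → constantOn b c ≡ true
      lem c mc with cycles⁻ σ G c mc
      ... | L , L<n , l , refl with P1 L in eL
      ...   | true = ∨-introˡ (∈-all P1 _ (λ x mx → trans (sym (Closed-Reach L<n (proj₂ (orbit⁻ σ G L x mx)))) eL))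
      ...   | false = ∨-introʳ {all P1 (orbit σ L)} (∈-all (not ∘ P1) _ (λ x mx →
                        not-false (trans (sym (Closed-Reach L<n (proj₂ (orbit⁻ σ G L x mx)))) eL)))

    Closed-complement : Closed σ P1 → Closed σ P2
    Closed-complement C i i<n = trans (P2≡ i<n) (trans (cong not (C i i<n)) (sym (P2≡ (proj₁ G i i<n))))

    f0≢f1 : ∀ x y → (f0 x ≡ᵇ f1 y) ≡ false
    f0≢f1 x y = ≢⇒≡ᵇ-false _ _ (disj x y)

    condI⇒Closed : condI σ Xt ≡ true → Closed σ P1
    condI⇒Closed e i i<n = lem
      where
      fi<n = proj₁ G i i<n
      eq : at Xt i ≡ at Xt (f i)
      eq = ≡ᵇ≡true⇒≡ _ _ (trans (condI-elim σ Xt e i (f i) i<n fi<n) (Reach⇒sameCycle σ G i<n (R-step σ G i)))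
      lem : P1 i ≡ P1 (f i)
      lem with P1 i in e1 | P1 (f i) in e2
      ... | true | true = refl
      ... | false | false = refl
      ... | true | false = ⊥-elim (disj _ _ (trans (sym (at-Xt1 i<n e1)) (trans eq (at-Xt2 fi<n e2))))
      ... | false | true = ⊥-elim (disj _ _ (trans (sym (at-Xt1 fi<n e2)) (trans (sym eq) (at-Xt2 i<n e1))))

    module WhenClosed (C : Closed σ P1) where
      C2 = Closed-complement C
      module A = Restricted σ G P1 C
      module B = Restricted σ G P2 C2
      module AI = RestrictedCondI σ G P1 C
      module BI = RestrictedCondI σ G P2 C2
      σ1 = restrictBy σ P1
      σ2 = restrictBy σ P2

      P1U : ∀ {i} → i ∈ A.U → P1 i ≡ true
      P1U mi = proj₂ (A.U⁻ mi)
      P2U : ∀ {i} → i ∈ B.U → P1 i ≡ false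
      P2U mi = not-true (trans (sym (P2≡ (proj₁ (B.U⁻ mi)))) (proj₂ (B.U⁻ mi)))

      condI-split : condI σ Xt ≡ condI σ1 Xu ∧ condI σ2 Xv
      condI-split = bool-ext fwd bwd
        where
        fwd : condI σ Xt ≡ true → condI σ1 Xu ∧ condI σ2 Xv ≡ true
        fwd e = ∧-intro
          (AI.condI-restricted-intro Xu λ {i} {j} mi mj →
            let i<n = proj₁ (A.U⁻ mi)
                j<n = proj₁ (A.U⁻ mj)
            in trans (sym (≡ᵇ-injective f0 inj0 _ _))
                 (trans (cong₂ _≡ᵇ_ (sym (at-Xt1 i<n (P1U mi))) (sym (at-Xt1 j<n (P1U mj))))
                   (condI-elim σ Xt e i j i<n j<n)))
          (BI.condI-restricted-intro Xv λ {i} {j} mi mj →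
            let i<n = proj₁ (B.U⁻ mi)
                j<n = proj₁ (B.U⁻ mj)
            in trans (sym (≡ᵇ-injective f1 inj1 _ _))
                 (trans (cong₂ _≡ᵇ_ (sym (at-Xt2 i<n (P2U mi))) (sym (at-Xt2 j<n (P2U mj))))
                   (condI-elim σ Xt e i j i<n j<n)))
        mixed : ∀ {i j} → i < n → j < n → P1 i ≡ true → P1 j ≡ false → sameCycle σ i j ≡ false
        mixed i<n j<n p q = ¬-not λ s → t≢f (trans (sym p) (trans (A.Closed-Reach i<n (sameCycle⇒Reach σ G _ _ s)) q))
        bwd : condI σ1 Xu ∧ condI σ2 Xv ≡ true → condI σ Xt ≡ true
        bwd e = condI-intro σ Xt lem
          where
          e1 = ∧-conicalˡ _ _ e
          e2 = ∧-conicalʳ (condI σ1 Xu) _ e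
          lem : ∀ i j → i < n → j < n → (at Xt i ≡ᵇ at Xt j) ≡ sameCycle σ i j
          lem i j i<n j<n with P1 i in p | P1 j in q
          ... | true | true = trans (cong₂ _≡ᵇ_ (at-Xt1 i<n p) (at-Xt1 j<n q))
                                (trans (≡ᵇ-injective f0 inj0 _ _) (AI.condI-restricted-elim Xu e1 (A.U⁺ i<n p) (A.U⁺ j<n q)))
          ... | false | false = trans (cong₂ _≡ᵇ_ (at-Xt2 i<n p) (at-Xt2 j<n q))
                                (trans (≡ᵇ-injective f1 inj1 _ _) (BI.condI-restricted-elim Xv e2
                                  (B.U⁺ i<n (trans (P2≡ i<n) (cong not p))) (B.U⁺ j<n (trans (P2≡ j<n) (cong not q)))))
          ... | true | false = trans (cong₂ _≡ᵇ_ (at-Xt1 i<n p) (at-Xt2 j<n q))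
                                (trans (f0≢f1 _ _) (sym (mixed i<n j<n p q)))
          ... | false | true = trans (cong₂ _≡ᵇ_ (at-Xt2 i<n p) (at-Xt1 j<n q))
                                (trans (trans (≡ᵇ-sym (f1 (at Xv (idx2 i))) _) (f0≢f1 _ _))
                                       (sym (trans sc-sym (mixed j<n i<n q p))))
            where
            sc-sym : sameCycle σ i j ≡ sameCycle σ j i
            sc-sym = bool-ext (λ s → Reach⇒sameCycle σ G j<n (R-sym σ G i<n (sameCycle⇒Reach σ G _ _ s)))
                                  (λ s → Reach⇒sameCycle σ G i<n (R-sym σ G j<n (sameCycle⇒Reach σ G _ _ s)))

      Ls = filterᵇ (isLeader σ) (upTo n)
      gW : ℕ → Bool
      gW L = any (listEqᵇ (inv (Std (map (at At) (orbit σ L))))) (cycleWords σ (orbit σ L))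

      LU1≡ : filterᵇ P1 Ls ≡ A.LU
      LU1≡ = trans (filter-filter P1 (isLeader σ) (upTo n))
        (trans (filter-cong _ _ (upTo n) (λ x _ → ∧-comm (isLeader σ x) (P1 x)))
               (sym (filter-filter (isLeader σ) P1 (upTo n))))

      LU2≡ : filterᵇ (not ∘ P1) Ls ≡ B.LU
      LU2≡ = trans (filter-filter (not ∘ P1) (isLeader σ) (upTo n))
        (trans (filter-cong _ _ (upTo n) (λ x mx → trans (∧-comm (isLeader σ x) (not (P1 x)))
                                                     (cong (_∧ isLeader σ x) (sym (P2≡ (∈-upTo⁻ mx))))))
               (sym (filter-filter (isLeader σ) P2 (upTo n))))

      condII-split : condII σ At ≡ condII σ1 Au ∧ condII σ2 Av
      condII-split = begin
          all _ (map (orbit σ) Ls)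
        ≡⟨ all-map _ (orbit σ) Ls ⟩
          all gW Ls
        ≡⟨ all-partition gW P1 Ls ⟩
          all gW (filterᵇ P1 Ls) ∧ all gW (filterᵇ (not ∘ P1) Ls)
        ≡⟨ cong₂ (λ a c → all gW a ∧ all gW c) LU1≡ LU2≡ ⟩
          all gW A.LU ∧ all gW B.LU
        ≡⟨ cong₂ _∧_ (sym (A.condII-restricted Au At (λ mi → sym (at-At1 (proj₁ (A.U⁻ mi)) (P1U mi)))))
                     (sym (B.condII-restricted Av At (λ mi → sym (at-At2 (proj₁ (B.U⁻ mi)) (P2U mi))))) ⟩
          condII σ1 Au ∧ condII σ2 Av ∎
        where open ≡-Reasoning

    σ1 = restrictBy σ P1
    σ2 = restrictBy σ P2

    len-t : length t ≡ n
    len-t = trans (length-merge b _ _ (trans cu (sym (length-map _ u))) (trans cv (sym (length-map _ v)))) lb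

    len-σ1 : length σ1 ≡ length u
    len-σ1 = trans (length-map _ (filterᵇ P1 (upTo n))) (trans (cong length U1≡) (trans (length-truePositions b) cu))

    len-σ2 : length σ2 ≡ length v
    len-σ2 = trans (length-map _ (filterᵇ P2 (upTo n))) (trans (cong length U2≡) (trans (length-truePositions (map not b)) cv))

    ∧-interchange : ∀ a c d e → (a ∧ c) ∧ (d ∧ e) ≡ (a ∧ d) ∧ (c ∧ e)
    ∧-interchange true true d e = refl
    ∧-interchange true false d e = sym (∧-zeroʳ d)
    ∧-interchange false c d e = refl

    lenT : (length t ≡ᵇ length σ) ≡ true
    lenT = trans (cong (_≡ᵇ n) len-t) (≡ᵇ-refl n)
    len1 : (length u ≡ᵇ length σ1) ≡ true
    len1 = trans (cong (length u ≡ᵇ_) len-σ1) (≡ᵇ-refl (length u))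
    len2 : (length v ≡ᵇ length σ2) ≡ true
    len2 = trans (cong (length v ≡ᵇ_) len-σ2) (≡ᵇ-refl (length v))

    isTermOf-merge : isTermOf σ t ≡ constantOnCycles σ b ∧ (isTermOf σ1 u ∧ isTermOf σ2 v)
    isTermOf-merge rewrite lenT | len1 | len2
      with constantOnCycles σ b in ec
    ... | false = lemF
      where
      lemF : condI σ Xt ∧ condII σ At ≡ false
      lemF with condI σ Xt in ei
      ... | false = refl
      ... | true = ⊥-elim (t≢f (trans (sym (Closed⇒constantOnCycles (condI⇒Closed ei))) ec))
    ... | true = trans (cong₂ _∧_ (WhenClosed.condI-split C) (WhenClosed.condII-split C)) (∧-interchange (condI σ1 Xu) (condI σ2 Xv) (condII σ1 Au) (condII σ2 Av))
      where C = constantOnCycles⇒Closed ec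

  condI-map-injective : ∀ σ (f : ℕ → ℕ) → (∀ x y → f x ≡ f y → x ≡ y) → ∀ X → length X ≡ length σ → condI σ (map f X) ≡ condI σ X
  condI-map-injective σ f inj X lw = all-cong _ _ (upTo (length σ)) λ i mi → all-cong _ _ (upTo (length σ)) λ j mj →
      let i< = subst (i ℕ.<_) (sym lw) (∈-upTo⁻ mi)
          j< = subst (j ℕ.<_) (sym lw) (∈-upTo⁻ mj)
      in cong (λ z → (z ∧ sameCycle σ i j) ∨ (not z ∧ not (sameCycle σ i j)))
           (trans (cong₂ ℕ._≡ᵇ_ (at-map f X i<) (at-map f X j<)) (≡ᵇ-injective f inj _ _))

  isTermOf-tag : ∀ σ (f : ℕ → ℕ) → (∀ x y → f x ≡ f y → x ≡ y) → ∀ w → isTermOf σ (map (tag f) w) ≡ isTermOf σ w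
  isTermOf-tag σ f inj w = trans (cong₂ (λ z y → (z ℕ.≡ᵇ length σ) ∧ (condI σ y ∧ condII σ (map proj₂ (map (tag f) w))))
                                      (length-map (tag f) w) mapX)
                                (trans (cong (λ z → (length w ℕ.≡ᵇ length σ) ∧ (condI σ (map f X) ∧ condII σ z)) mapA) main)
    where
    X = map proj₁ w
    mapX : map proj₁ (map (tag f) w) ≡ map f X
    mapX = trans (sym (map-∘ w)) (map-∘ w)
    mapA : map proj₂ (map (tag f) w) ≡ map proj₂ w
    mapA = sym (map-∘ w)
    main : (length w ℕ.≡ᵇ length σ) ∧ (condI σ (map f X) ∧ condII σ (map proj₂ w)) ≡ isTermOf σ w
    main with length w ℕ.≡ᵇ length σ in e
    ... | false = refl
    ... | true = cong (_∧ condII σ (map proj₂ w)) (condI-map-injective σ f inj X (trans (length-map proj₁ w) (≡ᵇ≡true⇒≡ _ _ e)))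


module FiniteSums {c ℓ} (R : CommutativeRing c ℓ) where

  open import Relation.Binary.PropositionalEquality as P using (_≡_)

  open CommutativeRing R
  open Series R public
  open import Relation.Binary.Reasoning.Setoid setoid
  import Algebra.Properties.CommutativeSemigroup as CS
  open CS +-commutativeSemigroup using (interchange)

  Σl-cong : ∀ {a} {A : Set a} {f g : A → Carrier} xs → (∀ x → f x ≈ g x) → Σl f xs ≈ Σl g xs
  Σl-cong [] h = refl
  Σl-cong (x ∷ xs) h = +-cong (h x) (Σl-cong xs h)

  Σl-cong-∈ : ∀ {a} {A : Set a} {f g : A → Carrier} xs → (∀ x → x ∈ xs → f x ≈ g x) → Σl f xs ≈ Σl g xs
  Σl-cong-∈ [] h = refl
  Σl-cong-∈ (x ∷ xs) h = +-cong (h x (here P.refl)) (Σl-cong-∈ xs (λ y m → h y (there m)))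

  Σl-++ : ∀ {a} {A : Set a} (f : A → Carrier) xs ys → Σl f (xs ++ ys) ≈ Σl f xs + Σl f ys
  Σl-++ f [] ys = sym (+-identityˡ _)
  Σl-++ f (x ∷ xs) ys = trans (+-congˡ (Σl-++ f xs ys)) (sym (+-assoc _ _ _))

  Σl-map : ∀ {a b} {A : Set a} {B : Set b} (f : B → Carrier) (g : A → B) xs → Σl f (map g xs) ≡ Σl (f ∘ g) xs
  Σl-map f g [] = P.refl
  Σl-map f g (x ∷ xs) = P.cong (f (g x) +_) (Σl-map f g xs)

  Σl-+ : ∀ {a} {A : Set a} (f g : A → Carrier) xs → Σl (λ x → f x + g x) xs ≈ Σl f xs + Σl g xs
  Σl-+ f g [] = sym (+-identityˡ _)
  Σl-+ f g (x ∷ xs) = trans (+-congˡ (Σl-+ f g xs)) (interchange _ _ _ _)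

  Σl-0 : ∀ {a} {A : Set a} (f : A → Carrier) xs → (∀ x → f x ≈ 0#) → Σl f xs ≈ 0#
  Σl-0 f [] h = refl
  Σl-0 f (x ∷ xs) h = trans (+-cong (h x) (Σl-0 f xs h)) (+-identityˡ _)

  Σl-concatMap : ∀ {a b} {A : Set a} {B : Set b} (f : B → Carrier) (g : A → List B) xs →
    Σl f (concatMap g xs) ≈ Σl (λ x → Σl f (g x)) xs
  Σl-concatMap f g [] = refl
  Σl-concatMap f g (x ∷ xs) = trans (Σl-++ f (g x) (concat (map g xs))) (+-congˡ (Σl-concatMap f g xs))

  indicator : Bool → Carrier → Carrier
  indicator b x = if b then x else 0#

  Σl-cong-All : ∀ {a} {A : Set a} {f g : A → Carrier} xs → All (λ x → f x ≈ g x) xs → Σl f xs ≈ Σl g xs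
  Σl-cong-All [] AllM.[] = refl
  Σl-cong-All (x ∷ xs) (p AllM.∷ ps) = +-cong p (Σl-cong-All xs ps)

  Σsplits-swap : ∀ cs (F : List (List ℕ) × List (List ℕ) → Carrier) →
    Σl F (splits cs) ≈ Σl (λ st → F (proj₂ st , proj₁ st)) (splits cs)
  Σsplits-swap [] F = refl
  Σsplits-swap (c ∷ cs) F = begin
      Σl F (splits (c ∷ cs))
    ≈⟨ Σl-concatMap F _ (splits cs) ⟩
      Σl (λ st → F (c ∷ proj₁ st , proj₂ st) + (F (proj₁ st , c ∷ proj₂ st) + 0#)) (splits cs)
    ≈⟨ Σl-cong (splits cs) (λ st → +-congˡ (+-identityʳ _)) ⟩
      Σl (λ st → F (c ∷ proj₁ st , proj₂ st) + F (proj₁ st , c ∷ proj₂ st)) (splits cs)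
    ≈⟨ Σsplits-swap cs (λ st → F (c ∷ proj₁ st , proj₂ st) + F (proj₁ st , c ∷ proj₂ st)) ⟩
      Σl (λ st → F (c ∷ proj₂ st , proj₁ st) + F (proj₂ st , c ∷ proj₁ st)) (splits cs)
    ≈⟨ Σl-cong (splits cs) (λ st → trans (+-comm _ _) (+-congˡ (sym (+-identityʳ _)))) ⟩
      Σl (λ st → F (proj₂ st , c ∷ proj₁ st) + (F (c ∷ proj₂ st , proj₁ st) + 0#)) (splits cs)
    ≈⟨ sym (Σl-concatMap (λ st → F (proj₂ st , proj₁ st)) _ (splits cs)) ⟩
      Σl (λ st → F (proj₂ st , proj₁ st)) (splits (c ∷ cs)) ∎


module Shuffles {c ℓ} (R : CommutativeRing c ℓ) where

  open import Data.Nat.Properties using (+-suc)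
  open import Relation.Binary.PropositionalEquality as P using (_≡_)
  open Merging using (merge; trues)

  open CommutativeRing R
  open FiniteSums R
  open import Relation.Binary.Reasoning.Setoid setoid
  import Algebra.Properties.CommutativeSemigroup as CS
  open CS +-commutativeSemigroup using (interchange)

  Σshuffle : Monomial → Monomial → (Monomial → Carrier) → Carrier
  Σshuffle [] [] G = G []
  Σshuffle (x ∷ a) [] G = Σshuffle a [] (λ w → G (x ∷ w))
  Σshuffle [] (y ∷ b) G = Σshuffle [] b (λ w → G (y ∷ w))
  Σshuffle (x ∷ a) (y ∷ b) G = Σshuffle a (y ∷ b) (λ w → G (x ∷ w)) + Σshuffle (x ∷ a) b (λ w → G (y ∷ w))

  Σshuffle-cong : ∀ a b {G H : Monomial → Carrier} → (∀ w → G w ≈ H w) → Σshuffle a b G ≈ Σshuffle a b H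
  Σshuffle-cong [] [] h = h []
  Σshuffle-cong (x ∷ a) [] h = Σshuffle-cong a [] (λ w → h (x ∷ w))
  Σshuffle-cong [] (y ∷ b) h = Σshuffle-cong [] b (λ w → h (y ∷ w))
  Σshuffle-cong (x ∷ a) (y ∷ b) h = +-cong (Σshuffle-cong a (y ∷ b) (λ w → h (x ∷ w))) (Σshuffle-cong (x ∷ a) b (λ w → h (y ∷ w)))

  Σshuffle-+ : ∀ a b (G H : Monomial → Carrier) → Σshuffle a b (λ w → G w + H w) ≈ Σshuffle a b G + Σshuffle a b H
  Σshuffle-+ [] [] G H = refl
  Σshuffle-+ (x ∷ a) [] G H = Σshuffle-+ a [] _ _
  Σshuffle-+ [] (y ∷ b) G H = Σshuffle-+ [] b _ _
  Σshuffle-+ (x ∷ a) (y ∷ b) G H = trans (+-cong (Σshuffle-+ a (y ∷ b) _ _) (Σshuffle-+ (x ∷ a) b _ _)) (interchange _ _ _ _)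

  Σshuffle-0 : ∀ a b → Σshuffle a b (λ _ → 0#) ≈ 0#
  Σshuffle-0 [] [] = refl
  Σshuffle-0 (x ∷ a) [] = Σshuffle-0 a []
  Σshuffle-0 [] (y ∷ b) = Σshuffle-0 [] b
  Σshuffle-0 (x ∷ a) (y ∷ b) = trans (+-cong (Σshuffle-0 a (y ∷ b)) (Σshuffle-0 (x ∷ a) b)) (+-identityˡ _)

  Σshuffle-*ˡ : ∀ a b (k : Carrier) (G : Monomial → Carrier) → k * Σshuffle a b G ≈ Σshuffle a b (λ w → k * G w)
  Σshuffle-*ˡ [] [] k G = refl
  Σshuffle-*ˡ (x ∷ a) [] k G = Σshuffle-*ˡ a [] k _
  Σshuffle-*ˡ [] (y ∷ b) k G = Σshuffle-*ˡ [] b k _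
  Σshuffle-*ˡ (x ∷ a) (y ∷ b) k G = trans (distribˡ k _ _) (+-cong (Σshuffle-*ˡ a (y ∷ b) k _) (Σshuffle-*ˡ (x ∷ a) b k _))

  Σshuffle-*ʳ : ∀ a b (k : Carrier) (G : Monomial → Carrier) → Σshuffle a b G * k ≈ Σshuffle a b (λ w → G w * k)
  Σshuffle-*ʳ a b k G = trans (*-comm _ k) (trans (Σshuffle-*ˡ a b k G) (Σshuffle-cong a b (λ w → *-comm k (G w))))

  Σshuffle-Σl : ∀ {la} {A : Set la} a b (F : Monomial → A → Carrier) xs →
    Σshuffle a b (λ w → Σl (F w) xs) ≈ Σl (λ x → Σshuffle a b (λ w → F w x)) xs
  Σshuffle-Σl a b F [] = Σshuffle-0 a b
  Σshuffle-Σl a b F (x ∷ xs) = trans (Σshuffle-+ a b _ _) (+-congˡ (Σshuffle-Σl a b F xs))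

  Σshuffle-map : ∀ (g : ℕ × ℕ → ℕ × ℕ) a b (G : Monomial → Carrier) → Σshuffle (map g a) (map g b) G ≡ Σshuffle a b (G ∘ map g)
  Σshuffle-map g [] [] G = P.refl
  Σshuffle-map g (x ∷ a) [] G = Σshuffle-map g a [] _
  Σshuffle-map g [] (y ∷ b) G = Σshuffle-map g [] b _
  Σshuffle-map g (x ∷ a) (y ∷ b) G = P.cong₂ _+_ (Σshuffle-map g a (y ∷ b) _) (Σshuffle-map g (x ∷ a) b _)

  Σshuffle-ext : ∀ a b {G H : Monomial → Carrier} → (∀ w → length w ≡ length a ℕ.+ length b → G w ≈ H w) → Σshuffle a b G ≈ Σshuffle a b H
  Σshuffle-ext [] [] h = h [] P.refl
  Σshuffle-ext (x ∷ a) [] h = Σshuffle-ext a [] (λ w e → h (x ∷ w) (P.cong suc e))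
  Σshuffle-ext [] (y ∷ b) h = Σshuffle-ext [] b (λ w e → h (y ∷ w) (P.cong suc e))
  Σshuffle-ext (x ∷ a) (y ∷ b) h = +-cong (Σshuffle-ext a (y ∷ b) (λ w e → h (x ∷ w) (P.cong suc e)))
                                    (Σshuffle-ext (x ∷ a) b (λ w e → h (y ∷ w) (P.trans (P.cong suc e) (P.sym (P.cong suc (+-suc (length a) (length b)))))))

  Σdeconc : (Monomial → Monomial → Carrier) → Monomial → Carrier
  Σdeconc H [] = H [] []
  Σdeconc H (x ∷ w) = H [] (x ∷ w) + Σdeconc (λ p q → H (x ∷ p) q) w

  Σdeconc-cong : ∀ w {G H : Monomial → Monomial → Carrier} → (∀ p q → G p q ≈ H p q) → Σdeconc G w ≈ Σdeconc H w
  Σdeconc-cong [] h = h [] []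
  Σdeconc-cong (x ∷ w) h = +-cong (h [] (x ∷ w)) (Σdeconc-cong w (λ p q → h (x ∷ p) q))

  Σdeconc-+ : ∀ w (G H : Monomial → Monomial → Carrier) → Σdeconc (λ p q → G p q + H p q) w ≈ Σdeconc G w + Σdeconc H w
  Σdeconc-+ [] G H = refl
  Σdeconc-+ (x ∷ w) G H = trans (+-congˡ (Σdeconc-+ w _ _)) (interchange _ _ _ _)

  Σdeconc-0 : ∀ w → Σdeconc (λ _ _ → 0#) w ≈ 0#
  Σdeconc-0 [] = refl
  Σdeconc-0 (x ∷ w) = trans (+-congˡ (Σdeconc-0 w)) (+-identityˡ _)

  Σdeconc-head : ∀ w (G : Monomial → Monomial → Carrier) (K : Monomial → Carrier) →
    (∀ q → G [] q ≈ K q) → (∀ x p q → G (x ∷ p) q ≈ 0#) → Σdeconc G w ≈ K w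
  Σdeconc-head [] G K h0 h1 = h0 []
  Σdeconc-head (x ∷ w) G K h0 h1 = trans (+-cong (h0 (x ∷ w)) (trans (Σdeconc-cong w (λ p q → h1 x p q)) (Σdeconc-0 w))) (+-identityʳ _)

  Σdeconc-tail : ∀ x w (G : Monomial → Monomial → Carrier) → (∀ q → G [] q ≈ 0#) →
    Σdeconc G (x ∷ w) ≈ Σdeconc (λ p q → G (x ∷ p) q) w
  Σdeconc-tail x w G h = trans (+-congʳ (h (x ∷ w))) (+-identityˡ _)

  prependˡ : (ℕ × ℕ) → (Monomial → Monomial → Carrier) → Monomial → Monomial → Carrier
  prependˡ x H p q = H (x ∷ p) q

  -- Both sides of Σshuffle-Σdeconc, and of Σshuffle-assoc below, are split
  -- according to which word supplies the first letter; the parts agree by induction.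
  private
    Q : (Monomial → Monomial → Carrier) → Monomial → Monomial → Monomial → Monomial → Carrier
    Q H p p' q q' = Σshuffle p p' (λ t1 → Σshuffle q q' (H t1))

    RHS : Monomial → Monomial → (Monomial → Monomial → Carrier) → Carrier
    RHS a b H = Σdeconc (λ p q → Σdeconc (λ p' q' → Q H p p' q q') b) a

    LHS : Monomial → Monomial → (Monomial → Monomial → Carrier) → Carrier
    LHS a b H = Σshuffle a b (Σdeconc H)

    Q0 : (Monomial → Monomial → Carrier) → Monomial → Monomial → Monomial → Monomial → Carrier
    Q0 H [] [] q q' = Σshuffle q q' (H [])
    Q0 H [] (y ∷ p') q q' = 0#
    Q0 H (x ∷ p) p' q q' = 0#

    Qx : (Monomial → Monomial → Carrier) → Monomial → Monomial → Monomial → Monomial → Carrier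
    Qx H [] p' q q' = 0#
    Qx H (x ∷ p) p' q q' = Q (prependˡ x H) p p' q q'

    Qy : (Monomial → Monomial → Carrier) → Monomial → Monomial → Monomial → Monomial → Carrier
    Qy H p [] q q' = 0#
    Qy H p (y ∷ p') q q' = Q (prependˡ y H) p p' q q'

    Q-dec : ∀ H p p' q q' → Q H p p' q q' ≈ Q0 H p p' q q' + (Qx H p p' q q' + Qy H p p' q q')
    Q-dec H [] [] q q' = sym (trans (+-congˡ (+-identityˡ _)) (+-identityʳ _))
    Q-dec H (x ∷ p) [] q q' = sym (trans (+-identityˡ _) (+-identityʳ _))
    Q-dec H [] (y ∷ p') q q' = sym (trans (+-identityˡ _) (+-identityˡ _))
    Q-dec H (x ∷ p) (y ∷ p') q q' = sym (+-identityˡ _)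

    Zpart : ∀ a b H → Σdeconc (λ p q → Σdeconc (λ p' q' → Q0 H p p' q q') b) a ≈ Σshuffle a b (H [])
    Zpart a b H = Σdeconc-head a _ (λ q → Σshuffle q b (H []))
      (λ q → Σdeconc-head b _ (λ q' → Σshuffle q q' (H [])) (λ q' → refl) (λ y p' q' → refl))
      (λ x p q → Σdeconc-0 b)

    XR : Monomial → Monomial → (Monomial → Monomial → Carrier) → Carrier
    XR [] b H = 0#
    XR (x ∷ a) b H = RHS a b (prependˡ x H)

    YR : Monomial → Monomial → (Monomial → Monomial → Carrier) → Carrier
    YR a [] H = 0#
    YR a (y ∷ b) H = RHS a b (prependˡ y H)

    Xpart : ∀ a b H → Σdeconc (λ p q → Σdeconc (λ p' q' → Qx H p p' q q') b) a ≈ XR a b H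
    Xpart [] b H = Σdeconc-0 b
    Xpart (x ∷ a) b H = Σdeconc-tail x a (λ p q → Σdeconc (λ p' q' → Qx H p p' q q') b) (λ q → Σdeconc-0 b)

    Ypart : ∀ a b H → Σdeconc (λ p q → Σdeconc (λ p' q' → Qy H p p' q q') b) a ≈ YR a b H
    Ypart a [] H = Σdeconc-0 a
    Ypart a (y ∷ b) H = Σdeconc-cong a (λ p q → Σdeconc-tail y b (λ p' q' → Qy H p p' q q') (λ q' → refl))

    RHS-dec : ∀ a b H → RHS a b H ≈ Σshuffle a b (H []) + (XR a b H + YR a b H)
    RHS-dec a b H = begin
        Σdeconc (λ p q → Σdeconc (λ p' q' → Q H p p' q q') b) a
      ≈⟨ Σdeconc-cong a (λ p q → trans (Σdeconc-cong b (λ p' q' → Q-dec H p p' q q'))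
                          (trans (Σdeconc-+ b _ _) (+-congˡ (Σdeconc-+ b _ _)))) ⟩
        Σdeconc (λ p q → Σdeconc (λ p' q' → Q0 H p p' q q') b + (Σdeconc (λ p' q' → Qx H p p' q q') b + Σdeconc (λ p' q' → Qy H p p' q q') b)) a
      ≈⟨ trans (Σdeconc-+ a _ _) (+-congˡ (Σdeconc-+ a _ _)) ⟩
        Σdeconc (λ p q → Σdeconc (λ p' q' → Q0 H p p' q q') b) a + (Σdeconc (λ p q → Σdeconc (λ p' q' → Qx H p p' q q') b) a + Σdeconc (λ p q → Σdeconc (λ p' q' → Qy H p p' q q') b) a)
      ≈⟨ +-cong (Zpart a b H) (+-cong (Xpart a b H) (Ypart a b H)) ⟩
        Σshuffle a b (H []) + (XR a b H + YR a b H) ∎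

    E : (Monomial → Monomial → Carrier) → Monomial → Carrier
    E H [] = 0#
    E H (x ∷ w) = Σdeconc (prependˡ x H) w

    XL : Monomial → Monomial → (Monomial → Monomial → Carrier) → Carrier
    XL [] b H = 0#
    XL (x ∷ a) b H = LHS a b (prependˡ x H)

    YL : Monomial → Monomial → (Monomial → Monomial → Carrier) → Carrier
    YL a [] H = 0#
    YL a (y ∷ b) H = LHS a b (prependˡ y H)

    E-dec : ∀ a b H → Σshuffle a b (E H) ≈ XL a b H + YL a b H
    E-dec [] [] H = sym (+-identityˡ _)
    E-dec (x ∷ a) [] H = sym (+-identityʳ _)
    E-dec [] (y ∷ b) H = sym (+-identityˡ _)
    E-dec (x ∷ a) (y ∷ b) H = refl

    LHS-dec : ∀ a b H → LHS a b H ≈ Σshuffle a b (H []) + (XL a b H + YL a b H)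
    LHS-dec a b H = trans (Σshuffle-cong a b (λ w → dcE w)) (trans (Σshuffle-+ a b _ _) (+-congˡ (E-dec a b H)))
      where
      dcE : ∀ w → Σdeconc H w ≈ H [] w + E H w
      dcE [] = sym (+-identityʳ _)
      dcE (x ∷ w) = refl

  Σshuffle-Σdeconc : ∀ a b (H : Monomial → Monomial → Carrier) →
    Σshuffle a b (Σdeconc H) ≈ Σdeconc (λ p q → Σdeconc (λ p' q' → Σshuffle p p' (λ t → Σshuffle q q' (H t))) b) a
  Σshuffle-Σdeconc [] [] H = refl
  Σshuffle-Σdeconc (x ∷ a) [] H = trans (LHS-dec (x ∷ a) [] H) (trans (+-congˡ (+-congʳ (Σshuffle-Σdeconc a [] (prependˡ x H)))) (sym (RHS-dec (x ∷ a) [] H)))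
  Σshuffle-Σdeconc [] (y ∷ b) H = trans (LHS-dec [] (y ∷ b) H) (trans (+-congˡ (+-congˡ (Σshuffle-Σdeconc [] b (prependˡ y H)))) (sym (RHS-dec [] (y ∷ b) H)))
  Σshuffle-Σdeconc (x ∷ a) (y ∷ b) H = trans (LHS-dec (x ∷ a) (y ∷ b) H)
    (trans (+-congˡ (+-cong (Σshuffle-Σdeconc a (y ∷ b) (prependˡ x H)) (Σshuffle-Σdeconc (x ∷ a) b (prependˡ y H)))) (sym (RHS-dec (x ∷ a) (y ∷ b) H)))

  private
    prepend : (ℕ × ℕ) → (Monomial → Carrier) → Monomial → Carrier
    prepend z F w = F (z ∷ w)

    shuffle3ˡ shuffle3ʳ : Monomial → Monomial → Monomial → (Monomial → Carrier) → Carrier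
    shuffle3ˡ a b c F = Σshuffle a b (λ x → Σshuffle x c F)
    shuffle3ʳ a b c F = Σshuffle b c (λ x → Σshuffle a x F)

    Z3 : Monomial → Monomial → Monomial → (Monomial → Carrier) → Carrier
    Z3 [] [] [] F = F []
    Z3 [] [] (w ∷ c) F = 0#
    Z3 [] (y ∷ b) c F = 0#
    Z3 (x ∷ a) b c F = 0#

    A3 = Monomial → Monomial → Monomial → (Monomial → Carrier) → Carrier

    XA3 YA3 WA3 : A3 → A3
    XA3 f [] b c F = 0#
    XA3 f (x ∷ a) b c F = f a b c (prepend x F)
    YA3 f a [] c F = 0#
    YA3 f a (y ∷ b) c F = f a b c (prepend y F)
    WA3 f a b [] F = 0#
    WA3 f a b (w ∷ c) F = f a b c (prepend w F)

    S0 Sx Sy : Monomial → (Monomial → Carrier) → Monomial → Carrier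
    S0 [] F [] = F []
    S0 (w ∷ c) F [] = 0#
    S0 c F (z ∷ x) = 0#
    Sx c F [] = 0#
    Sx c F (z ∷ x) = Σshuffle x c (prepend z F)
    Sy [] F x = 0#
    Sy (w ∷ c) F x = Σshuffle x c (prepend w F)

    sdecL : ∀ x c F → Σshuffle x c F ≈ S0 c F x + (Sx c F x + Sy c F x)
    sdecL [] [] F = sym (trans (+-congˡ (+-identityˡ _)) (+-identityʳ _))
    sdecL (z ∷ x) [] F = sym (trans (+-identityˡ _) (+-identityʳ _))
    sdecL [] (w ∷ c) F = sym (trans (+-identityˡ _) (+-identityˡ _))
    sdecL (z ∷ x) (w ∷ c) F = sym (+-identityˡ _)

    S0∷ : ∀ c F z w → S0 c F (z ∷ w) ≈ 0#
    S0∷ [] F z w = refl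
    S0∷ (_ ∷ _) F z w = refl

    L-s0 : ∀ a b c F → Σshuffle a b (S0 c F) ≈ Z3 a b c F
    L-s0 [] [] [] F = refl
    L-s0 [] [] (w ∷ c) F = refl
    L-s0 [] (y ∷ b) c F = trans (Σshuffle-cong [] b (λ w → S0∷ c F y w)) (Σshuffle-0 [] b)
    L-s0 (x ∷ a) [] c F = trans (Σshuffle-cong a [] (λ w → S0∷ c F x w)) (Σshuffle-0 a [])
    L-s0 (x ∷ a) (y ∷ b) c F = trans (+-cong (trans (Σshuffle-cong a (y ∷ b) (λ w → S0∷ c F x w)) (Σshuffle-0 a (y ∷ b)))
                                             (trans (Σshuffle-cong (x ∷ a) b (λ w → S0∷ c F y w)) (Σshuffle-0 (x ∷ a) b))) (+-identityˡ _)

    L-sx : ∀ a b c F → Σshuffle a b (Sx c F) ≈ XA3 shuffle3ˡ a b c F + YA3 shuffle3ˡ a b c F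
    L-sx [] [] c F = sym (+-identityˡ _)
    L-sx (x ∷ a) [] c F = sym (+-identityʳ _)
    L-sx [] (y ∷ b) c F = sym (+-identityˡ _)
    L-sx (x ∷ a) (y ∷ b) c F = refl

    L-sy : ∀ a b c F → Σshuffle a b (Sy c F) ≈ WA3 shuffle3ˡ a b c F
    L-sy a b [] F = Σshuffle-0 a b
    L-sy a b (w ∷ c) F = refl

    A3L-dec : ∀ a b c F → shuffle3ˡ a b c F ≈ Z3 a b c F + (XA3 shuffle3ˡ a b c F + (YA3 shuffle3ˡ a b c F + WA3 shuffle3ˡ a b c F))
    A3L-dec a b c F = begin
        Σshuffle a b (λ x → Σshuffle x c F)
      ≈⟨ Σshuffle-cong a b (λ x → sdecL x c F) ⟩
        Σshuffle a b (λ x → S0 c F x + (Sx c F x + Sy c F x))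
      ≈⟨ trans (Σshuffle-+ a b _ _) (+-congˡ (Σshuffle-+ a b _ _)) ⟩
        Σshuffle a b (S0 c F) + (Σshuffle a b (Sx c F) + Σshuffle a b (Sy c F))
      ≈⟨ +-cong (L-s0 a b c F) (+-cong (L-sx a b c F) (L-sy a b c F)) ⟩
        Z3 a b c F + ((XA3 shuffle3ˡ a b c F + YA3 shuffle3ˡ a b c F) + WA3 shuffle3ˡ a b c F)
      ≈⟨ +-congˡ (+-assoc _ _ _) ⟩
        Z3 a b c F + (XA3 shuffle3ˡ a b c F + (YA3 shuffle3ˡ a b c F + WA3 shuffle3ˡ a b c F)) ∎

    Tnil Ta Tx : Monomial → (Monomial → Carrier) → Monomial → Carrier
    Tnil [] F [] = F []
    Tnil [] F (w ∷ x) = 0#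
    Tnil (z ∷ a) F x = 0#
    Ta [] F x = 0#
    Ta (z ∷ a) F x = Σshuffle a x (prepend z F)
    Tx a F [] = 0#
    Tx a F (w ∷ x) = Σshuffle a x (prepend w F)

    sdecR : ∀ a x F → Σshuffle a x F ≈ Tnil a F x + (Ta a F x + Tx a F x)
    sdecR [] [] F = sym (trans (+-congˡ (+-identityˡ _)) (+-identityʳ _))
    sdecR (z ∷ a) [] F = sym (trans (+-identityˡ _) (+-identityʳ _))
    sdecR [] (w ∷ x) F = sym (trans (+-identityˡ _) (+-identityˡ _))
    sdecR (z ∷ a) (w ∷ x) F = sym (+-identityˡ _)

    R-tnil : ∀ a b c F → Σshuffle b c (Tnil a F) ≈ Z3 a b c F
    R-tnil (z ∷ a) b c F = Σshuffle-0 b c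
    R-tnil [] [] [] F = refl
    R-tnil [] [] (w ∷ c) F = Σshuffle-0 [] c
    R-tnil [] (y ∷ b) [] F = Σshuffle-0 b []
    R-tnil [] (y ∷ b) (w ∷ c) F = trans (+-cong (Σshuffle-0 b (w ∷ c)) (Σshuffle-0 (y ∷ b) c)) (+-identityˡ _)

    R-ta : ∀ a b c F → Σshuffle b c (Ta a F) ≈ XA3 shuffle3ʳ a b c F
    R-ta [] b c F = Σshuffle-0 b c
    R-ta (z ∷ a) b c F = refl

    R-tx : ∀ a b c F → Σshuffle b c (Tx a F) ≈ YA3 shuffle3ʳ a b c F + WA3 shuffle3ʳ a b c F
    R-tx a [] [] F = sym (+-identityˡ _)
    R-tx a (y ∷ b) [] F = sym (+-identityʳ _)
    R-tx a [] (w ∷ c) F = sym (+-identityˡ _)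
    R-tx a (y ∷ b) (w ∷ c) F = refl

    A3R-dec : ∀ a b c F → shuffle3ʳ a b c F ≈ Z3 a b c F + (XA3 shuffle3ʳ a b c F + (YA3 shuffle3ʳ a b c F + WA3 shuffle3ʳ a b c F))
    A3R-dec a b c F = begin
        Σshuffle b c (λ x → Σshuffle a x F)
      ≈⟨ Σshuffle-cong b c (λ x → sdecR a x F) ⟩
        Σshuffle b c (λ x → Tnil a F x + (Ta a F x + Tx a F x))
      ≈⟨ trans (Σshuffle-+ b c _ _) (+-congˡ (Σshuffle-+ b c _ _)) ⟩
        Σshuffle b c (Tnil a F) + (Σshuffle b c (Ta a F) + Σshuffle b c (Tx a F))
      ≈⟨ +-cong (R-tnil a b c F) (+-cong (R-ta a b c F) (R-tx a b c F)) ⟩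
        Z3 a b c F + (XA3 shuffle3ʳ a b c F + (YA3 shuffle3ʳ a b c F + WA3 shuffle3ʳ a b c F)) ∎

  Σshuffle-assoc : ∀ a b c (F : Monomial → Carrier) →
    Σshuffle a b (λ x → Σshuffle x c F) ≈ Σshuffle b c (λ y → Σshuffle a y F)
  Σshuffle-assoc a b c F = trans (A3L-dec a b c F) (trans (+-congˡ (+-cong (X a b c F) (+-cong (Y a b c F) (W a b c F)))) (sym (A3R-dec a b c F)))
    where
    X : ∀ a b c F → XA3 shuffle3ˡ a b c F ≈ XA3 shuffle3ʳ a b c F
    Y : ∀ a b c F → YA3 shuffle3ˡ a b c F ≈ YA3 shuffle3ʳ a b c F
    W : ∀ a b c F → WA3 shuffle3ˡ a b c F ≈ WA3 shuffle3ʳ a b c F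
    X [] b c F = refl
    X (x ∷ a) b c F = Σshuffle-assoc a b c (prepend x F)
    Y a [] c F = refl
    Y a (y ∷ b) c F = Σshuffle-assoc a b c (prepend y F)
    W a b [] F = refl
    W a b (w ∷ c) F = Σshuffle-assoc a b c (prepend w F)

  Σsplit≈Σdeconc : ∀ w (K : Monomial → Monomial → Carrier) →
    Σl (λ k → K (take k w) (drop k w)) (upTo (suc (length w))) ≈ Σdeconc K w
  Σsplit≈Σdeconc [] K = +-identityʳ _
  Σsplit≈Σdeconc (x ∷ w) K = +-congˡ (P.subst (_≈ Σdeconc (prependˡ x K) w) (P.sym e) (Σsplit≈Σdeconc w (prependˡ x K)))
    where
    F = λ k → K (take k (x ∷ w)) (drop k (x ∷ w))
    e : Σl F (applyUpTo suc (suc (length w))) ≡ Σl (λ k → F (suc k)) (upTo (suc (length w)))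
    e = P.trans (P.cong (Σl F) (P.sym (map-upTo suc (suc (length w))))) (Σl-map F suc (upTo (suc (length w))))

  ⋆≈Σdeconc : ∀ f g w → (f ⋆ g) w ≈ Σdeconc (λ p q → f p * g q) w
  ⋆≈Σdeconc f g w = Σsplit≈Σdeconc w _

  ⊛≈Σdeconc : ∀ F G u v → (F ⊛ G) u v ≈ Σdeconc (λ p q → Σdeconc (λ p' q' → F p p' * G q q') v) u
  ⊛≈Σdeconc F G u v = trans (Σsplit≈Σdeconc u _) (Σdeconc-cong u (λ p q → Σsplit≈Σdeconc v _))

  masks : ℕ → List (List Bool)
  masks zero = [] ∷ []
  masks (suc n) = map (true ∷_) (masks n) ++ map (false ∷_) (masks n)

  masks-length : ∀ n {b} → b ∈ masks n → length b ≡ n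
  masks-length zero (here P.refl) = P.refl
  masks-length (suc n) {b} m with ∈-++⁻ (map (true ∷_) (masks n)) m
  ... | inj₁ m' with ∈-map⁻ (true ∷_) m'
  ...   | b' , mb , P.refl = P.cong suc (masks-length n mb)
  masks-length (suc n) {b} m | inj₂ m' with ∈-map⁻ (false ∷_) m'
  ...   | b' , mb , P.refl = P.cong suc (masks-length n mb)

  trues≤length : ∀ b → trues b ℕ.≤ length b
  trues≤length [] = ℕ.z≤n
  trues≤length (true ∷ b) = ℕ.s≤s (trues≤length b)
  trues≤length (false ∷ b) = ℕₚ.m≤n⇒m≤1+n (trues≤length b)

  <⇒≡ᵇ-false : ∀ m n → m ℕ.< n → (m ℕ.≡ᵇ n) ≡ false
  <⇒≡ᵇ-false zero (suc n) p = P.refl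
  <⇒≡ᵇ-false (suc m) (suc n) (ℕ.s≤s p) = <⇒≡ᵇ-false m n p

  Σl-masks-suc : ∀ n (F : List Bool → Carrier) → Σl F (masks (suc n)) ≈ Σl (λ b → F (true ∷ b)) (masks n) + Σl (λ b → F (false ∷ b)) (masks n)
  Σl-masks-suc n F = trans (Σl-++ F (map (true ∷_) (masks n)) (map (false ∷_) (masks n))) (+-cong (reflexive (Σl-map F (true ∷_) (masks n))) (reflexive (Σl-map F (false ∷_) (masks n))))

  Σshuffle≈Σmasks : ∀ a c (G : Monomial → Carrier) → Σshuffle a c G ≈
    Σl (λ b → indicator (trues b ℕ.≡ᵇ length a) (G (merge b a c))) (masks (length a ℕ.+ length c))
  Σshuffle≈Σmasks [] [] G = sym (+-identityʳ _)
  Σshuffle≈Σmasks (x ∷ a) [] G = sym (trans (Σl-masks-suc (length a ℕ.+ 0) (λ b → indicator (trues b ℕ.≡ᵇ suc (length a)) (G (merge b (x ∷ a) []))))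
    (trans (+-congˡ (trans (Σl-cong-∈ (masks (length a ℕ.+ 0)) (λ b mb → lem b mb)) (Σl-0 (λ _ → 0#) (masks (length a ℕ.+ 0)) (λ _ → refl)))) (trans (+-identityʳ _) (sym (Σshuffle≈Σmasks a [] (λ w → G (x ∷ w)))))))
    where
    lem : ∀ b → b ∈ masks (length a ℕ.+ 0) → indicator (trues b ℕ.≡ᵇ suc (length a)) (G (merge (false ∷ b) (x ∷ a) [])) ≈ 0#
    lem b mb rewrite <⇒≡ᵇ-false (trues b) (suc (length a))
      (ℕ.s≤s (P.subst (trues b ℕ.≤_) (P.trans (masks-length _ mb) (ℕₚ.+-identityʳ (length a))) (trues≤length b))) = refl
  Σshuffle≈Σmasks [] (y ∷ c) G = sym (trans (Σl-masks-suc (length c) (λ b → indicator (trues b ℕ.≡ᵇ 0) (G (merge b [] (y ∷ c)))))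
    (trans (+-congʳ (Σl-0 _ (masks (length c)) (λ b → refl))) (trans (+-identityˡ _) (sym (Σshuffle≈Σmasks [] c (λ w → G (y ∷ w)))))))
  Σshuffle≈Σmasks (x ∷ a) (y ∷ c) G = sym (trans (Σl-masks-suc (length a ℕ.+ suc (length c)) (λ b → indicator (trues b ℕ.≡ᵇ suc (length a)) (G (merge b (x ∷ a) (y ∷ c))))) (+-cong (sym (Σshuffle≈Σmasks a (y ∷ c) (λ w → G (x ∷ w))))
    (P.subst (λ z → Σl (λ b → indicator (trues b ℕ.≡ᵇ suc (length a)) (G (y ∷ merge b (x ∷ a) c))) (masks z) ≈ Σshuffle (x ∷ a) c (λ w → G (y ∷ w)))
       (P.sym (+-suc (length a) (length c))) (sym (Σshuffle≈Σmasks (x ∷ a) c (λ w → G (y ∷ w)))))))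

  Σshuffle-[]ˡ : ∀ b (G : Monomial → Carrier) → Σshuffle [] b G ≡ G b
  Σshuffle-[]ˡ [] G = P.refl
  Σshuffle-[]ˡ (y ∷ b) G = Σshuffle-[]ˡ b (λ w → G (y ∷ w))

  Σshuffle-[]ʳ : ∀ a (G : Monomial → Carrier) → Σshuffle a [] G ≡ G a
  Σshuffle-[]ʳ [] G = P.refl
  Σshuffle-[]ʳ (x ∷ a) G = Σshuffle-[]ʳ a (λ w → G (x ∷ w))

  Σdeconc-map : ∀ (g : ℕ × ℕ → ℕ × ℕ) (H : Monomial → Monomial → Carrier) w → Σdeconc H (map g w) ≡ Σdeconc (λ p q → H (map g p) (map g q)) w
  Σdeconc-map g H [] = P.refl
  Σdeconc-map g H (x ∷ w) = P.cong (H [] (g x ∷ map g w) +_) (Σdeconc-map g (λ p q → H (g x ∷ p) q) w)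


module Masks where

  open Basics
  open Cycles using (inUnion; Disjoint)
  open Merging using (bitAt)
  open MergedTerms using (constantOn)
  open import Relation.Binary.PropositionalEquality as P using (_≡_)

  boolEq : Bool → Bool → Bool
  boolEq true y = y
  boolEq false y = not y

  boolEq⇒≡ : ∀ x y → boolEq x y ≡ true → x ≡ y
  boolEq⇒≡ true true e = P.refl
  boolEq⇒≡ false false e = P.refl
  boolEq⇒≡ true false ()
  boolEq⇒≡ false true ()

  ≡⇒boolEq : ∀ {x y} → x ≡ y → boolEq x y ≡ true
  ≡⇒boolEq {true} P.refl = P.refl
  ≡⇒boolEq {false} P.refl = P.refl

  agreesOff : ℕ → List Bool → (ℕ → Bool) → List (List ℕ) → Bool
  agreesOff n b D cs = all (λ i → inUnion cs i ∨ boolEq (bitAt b i) (D i)) (upTo n)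

  tabulateBits : ℕ → (ℕ → Bool) → List Bool
  tabulateBits n P = map P (upTo n)

  splitMask : (ℕ → Bool) → List (List ℕ) → List (List ℕ) → ℕ → Bool
  splitMask D cs s i = if inUnion s i then true else if inUnion cs i then false else D i

  tabulateBits-suc : ∀ n P → tabulateBits (suc n) P ≡ P 0 ∷ tabulateBits n (P ∘ suc)
  tabulateBits-suc n P = P.cong (P 0 ∷_) (P.trans (map-applyUpTo suc P n) (P.sym (map-upTo (P ∘ suc) n)))

  bitAt-tabulateBits : ∀ n P i → i < n → bitAt (tabulateBits n P) i ≡ P i
  bitAt-tabulateBits (suc n) P zero p = P.refl
  bitAt-tabulateBits (suc n) P (suc i) (s≤s p) = P.trans (P.cong (λ l → bitAt l (suc i)) (tabulateBits-suc n P)) (bitAt-tabulateBits n (P ∘ suc) i p)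

  tabulateBits-cong : ∀ n P Q → (∀ i → i < n → P i ≡ Q i) → tabulateBits n P ≡ tabulateBits n Q
  tabulateBits-cong n P Q h = map-cong-∈ P Q (upTo n) (λ i m → h i (∈-upTo⁻ m))

  agreesOff-elim : ∀ n b D cs → agreesOff n b D cs ≡ true → ∀ i → i < n → inUnion cs i ≡ false → bitAt b i ≡ D i
  agreesOff-elim n b D cs e i i<n q with all-∈ _ e (∈-upTo⁺ i<n)
  ... | r rewrite q = boolEq⇒≡ _ _ r

  agreesOff-intro : ∀ n b D cs → (∀ i → i < n → inUnion cs i ≡ false → bitAt b i ≡ D i) → agreesOff n b D cs ≡ true
  agreesOff-intro n b D cs h = ∈-all _ (upTo n) λ i m → lem i (∈-upTo⁻ m)
    where
    lem : ∀ i → i < n → (inUnion cs i ∨ boolEq (bitAt b i) (D i)) ≡ true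
    lem i i<n with inUnion cs i in q
    ... | true = P.refl
    ... | false = ≡⇒boolEq (h i i<n q)

  all-upTo-suc : ∀ (p : ℕ → Bool) n → all p (upTo (suc n)) ≡ p 0 ∧ all (p ∘ suc) (upTo n)
  all-upTo-suc p n = P.cong (p 0 ∧_) (P.trans (P.cong (all p) (P.sym (map-upTo suc n))) (all-map p suc (upTo n)))


module MaskedSums {c ℓ} (R : CommutativeRing c ℓ) where

  open Basics
  open Cycles using (inUnion; Disjoint)
  open Merging using (bitAt)
  open MergedTerms using (constantOn)
  open Masks
  open import Relation.Binary.PropositionalEquality as P using (_≡_)

  open CommutativeRing R
  open FiniteSums R
  open Shuffles R
  open import Relation.Binary.Reasoning.Setoid setoid

  ind-∧ : ∀ x y (v : Carrier) → indicator (x ∧ y) v ≡ (if x then indicator y v else 0#)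
  ind-∧ true y v = P.refl
  ind-∧ false y v = P.refl

  Σmasks-agreeing : ∀ n (D : ℕ → Bool) (F : List Bool → Carrier) →
    Σl (λ b → indicator (all (λ i → boolEq (bitAt b i) (D i)) (upTo n)) (F b)) (masks n) ≈ F (tabulateBits n D)
  Σmasks-agreeing zero D F = +-identityʳ _
  Σmasks-agreeing (suc n) D F = trans (Σl-masks-suc n _) (lem (D 0) P.refl)
    where
    cond : List Bool → Bool
    cond b = all (λ i → boolEq (bitAt b i) (D (suc i))) (upTo n)
    eT : ∀ b → indicator (all (λ i → boolEq (bitAt (true ∷ b) i) (D i)) (upTo (suc n))) (F (true ∷ b))
               ≡ (if boolEq true (D 0) then indicator (cond b) (F (true ∷ b)) else 0#)
    eT b = P.trans (P.cong (λ z → indicator z (F (true ∷ b))) (all-upTo-suc _ n)) (ind-∧ (boolEq true (D 0)) _ _)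
    eF : ∀ b → indicator (all (λ i → boolEq (bitAt (false ∷ b) i) (D i)) (upTo (suc n))) (F (false ∷ b))
               ≡ (if boolEq false (D 0) then indicator (cond b) (F (false ∷ b)) else 0#)
    eF b = P.trans (P.cong (λ z → indicator z (F (false ∷ b))) (all-upTo-suc _ n)) (ind-∧ (boolEq false (D 0)) _ _)
    lem : ∀ d → D 0 ≡ d →
      Σl (λ b → indicator (all (λ i → boolEq (bitAt (true ∷ b) i) (D i)) (upTo (suc n))) (F (true ∷ b))) (masks n) +
      Σl (λ b → indicator (all (λ i → boolEq (bitAt (false ∷ b) i) (D i)) (upTo (suc n))) (F (false ∷ b))) (masks n)
      ≈ F (tabulateBits (suc n) D)
    lem true e = begin
        _
      ≈⟨ +-cong (Σl-cong (masks n) (λ b → reflexive (P.trans (eT b) (P.cong (λ z → if boolEq true z then indicator (cond b) (F (true ∷ b)) else 0#) e))))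
                (Σl-cong (masks n) (λ b → reflexive (P.trans (eF b) (P.cong (λ z → if boolEq false z then indicator (cond b) (F (false ∷ b)) else 0#) e)))) ⟩
        Σl (λ b → indicator (cond b) (F (true ∷ b))) (masks n) + Σl (λ b → 0#) (masks n)
      ≈⟨ +-cong (Σmasks-agreeing n (D ∘ suc) (λ b → F (true ∷ b))) (Σl-0 _ (masks n) (λ _ → refl)) ⟩
        F (true ∷ tabulateBits n (D ∘ suc)) + 0#
      ≈⟨ +-identityʳ _ ⟩
        F (true ∷ tabulateBits n (D ∘ suc))
      ≈⟨ reflexive (P.cong F (P.sym (P.trans (tabulateBits-suc n D) (P.cong (_∷ tabulateBits n (D ∘ suc)) e)))) ⟩
        F (tabulateBits (suc n) D) ∎
    lem false e = begin
        _
      ≈⟨ +-cong (Σl-cong (masks n) (λ b → reflexive (P.trans (eT b) (P.cong (λ z → if boolEq true z then indicator (cond b) (F (true ∷ b)) else 0#) e))))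
                (Σl-cong (masks n) (λ b → reflexive (P.trans (eF b) (P.cong (λ z → if boolEq false z then indicator (cond b) (F (false ∷ b)) else 0#) e)))) ⟩
        Σl (λ b → 0#) (masks n) + Σl (λ b → indicator (cond b) (F (false ∷ b))) (masks n)
      ≈⟨ +-cong (Σl-0 _ (masks n) (λ _ → refl)) (Σmasks-agreeing n (D ∘ suc) (λ b → F (false ∷ b))) ⟩
        0# + F (false ∷ tabulateBits n (D ∘ suc))
      ≈⟨ +-identityˡ _ ⟩
        F (false ∷ tabulateBits n (D ∘ suc))
      ≈⟨ reflexive (P.cong F (P.sym (P.trans (tabulateBits-suc n D) (P.cong (_∷ tabulateBits n (D ∘ suc)) e)))) ⟩
        F (tabulateBits (suc n) D) ∎

  indicator-∨-disjoint : ∀ T Fa A X (v : Carrier) → T ∧ Fa ≡ false →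
    indicator ((T ∨ Fa) ∧ (A ∧ X)) v ≈ indicator (A ∧ (T ∧ X)) v + indicator (A ∧ (Fa ∧ X)) v
  indicator-∨-disjoint true true A X v ()
  indicator-∨-disjoint true false true true v e = sym (+-identityʳ _)
  indicator-∨-disjoint true false true false v e = sym (+-identityʳ _)
  indicator-∨-disjoint true false false X v e = sym (+-identityʳ _)
  indicator-∨-disjoint false true true true v e = sym (+-identityˡ _)
  indicator-∨-disjoint false true true false v e = sym (+-identityˡ _)
  indicator-∨-disjoint false true false X v e = sym (+-identityˡ _)
  indicator-∨-disjoint false false true X v e = sym (+-identityˡ _)
  indicator-∨-disjoint false false false X v e = sym (+-identityˡ _)

  module AddCycle (n : ℕ) (c : List ℕ) (cs : List (List ℕ)) (c-disj : ∀ i → i ∈ c → inUnion cs i ≡ false)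
              (cne : ∃ λ i → i ∈ c) (cb : ∀ i → i ∈ c → i < n) (D : ℕ → Bool) where
    Dt Df : ℕ → Bool
    Dt i = if elemᵇ i c then true else D i
    Df i = if elemᵇ i c then false else D i

    agreeT : ∀ b → agreesOff n b Dt cs ≡ all (bitAt b) c ∧ agreesOff n b D (c ∷ cs)
    agreeT b = bool-ext fwd bwd
      where
      fwd : agreesOff n b Dt cs ≡ true → all (bitAt b) c ∧ agreesOff n b D (c ∷ cs) ≡ true
      fwd e = ∧-intro (∈-all (bitAt b) c (λ i m → P.trans (agreesOff-elim n b Dt cs e i (cb i m) (c-disj i m))
                                                   (P.cong (λ z → if z then true else D i) (∈-elemᵇ m))))
                      (agreesOff-intro n b D (c ∷ cs) λ i i<n q →
                         let q1 = ∨-conicalˡ (elemᵇ i c) _ q; q2 = ∨-conicalʳ (elemᵇ i c) _ q in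
                         P.trans (agreesOff-elim n b Dt cs e i i<n q2) (P.cong (λ z → if z then true else D i) q1))
      bwd : all (bitAt b) c ∧ agreesOff n b D (c ∷ cs) ≡ true → agreesOff n b Dt cs ≡ true
      bwd e = agreesOff-intro n b Dt cs λ i i<n q → lem i i<n q
        where
        lem : ∀ i → i < n → inUnion cs i ≡ false → bitAt b i ≡ Dt i
        lem i i<n q with elemᵇ i c in ec
        ... | true = all-∈ (bitAt b) (∧-conicalˡ _ _ e) (elemᵇ-∈ i c ec)
        ... | false = agreesOff-elim n b D (c ∷ cs) (∧-conicalʳ (all (bitAt b) c) _ e) i i<n
                        (P.trans (P.cong (_∨ inUnion cs i) ec) q)

    agreeF : ∀ b → agreesOff n b Df cs ≡ all (not ∘ bitAt b) c ∧ agreesOff n b D (c ∷ cs)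
    agreeF b = bool-ext fwd bwd
      where
      fwd : agreesOff n b Df cs ≡ true → all (not ∘ bitAt b) c ∧ agreesOff n b D (c ∷ cs) ≡ true
      fwd e = ∧-intro (∈-all (not ∘ bitAt b) c (λ i m → not-false (P.trans (agreesOff-elim n b Df cs e i (cb i m) (c-disj i m))
                                                   (P.cong (λ z → if z then false else D i) (∈-elemᵇ m)))))
                      (agreesOff-intro n b D (c ∷ cs) λ i i<n q →
                         let q1 = ∨-conicalˡ (elemᵇ i c) _ q; q2 = ∨-conicalʳ (elemᵇ i c) _ q in
                         P.trans (agreesOff-elim n b Df cs e i i<n q2) (P.cong (λ z → if z then false else D i) q1))
      bwd : all (not ∘ bitAt b) c ∧ agreesOff n b D (c ∷ cs) ≡ true → agreesOff n b Df cs ≡ true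
      bwd e = agreesOff-intro n b Df cs λ i i<n q → lem i i<n q
        where
        lem : ∀ i → i < n → inUnion cs i ≡ false → bitAt b i ≡ Df i
        lem i i<n q with elemᵇ i c in ec
        ... | true = not-true (all-∈ (not ∘ bitAt b) (∧-conicalˡ _ _ e) (elemᵇ-∈ i c ec))
        ... | false = agreesOff-elim n b D (c ∷ cs) (∧-conicalʳ (all (not ∘ bitAt b) c) _ e) i i<n
                        (P.trans (P.cong (_∨ inUnion cs i) ec) q)

    TF : ∀ b → all (bitAt b) c ∧ all (not ∘ bitAt b) c ≡ false
    TF b = ¬-not λ e → let (i , m) = cne in
      t≢f (P.sym (P.subst (λ z → not z ≡ true) (all-∈ (bitAt b) (∧-conicalˡ _ _ e) m)
                           (all-∈ (not ∘ bitAt b) (∧-conicalʳ (all (bitAt b) c) _ e) m)))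

    mt : ∀ s i → splitMask Dt cs s i ≡ splitMask D (c ∷ cs) (c ∷ s) i
    mt s i with elemᵇ i c in ec
    ... | false = P.refl
    ... | true rewrite c-disj i (elemᵇ-∈ i c ec) with inUnion s i
    ...   | true = P.refl
    ...   | false = P.refl

    mf : ∀ s i → splitMask Df cs s i ≡ splitMask D (c ∷ cs) s i
    mf s i with elemᵇ i c in ec
    ... | false = P.refl
    ... | true rewrite c-disj i (elemᵇ-∈ i c ec) with inUnion s i
    ...   | true = P.refl
    ...   | false = P.refl

  Σmasks≈Σsplits : ∀ n cs → Disjoint cs → (∀ c → c ∈ cs → ∃ λ i → i ∈ c) → (∀ c i → c ∈ cs → i ∈ c → i < n) →
    ∀ (D : ℕ → Bool) (F : List Bool → Carrier) →
    Σl (λ b → indicator (all (constantOn b) cs ∧ agreesOff n b D cs) (F b)) (masks n) ≈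
    Σl (λ st → F (tabulateBits n (splitMask D cs (proj₁ st)))) (splits cs)
  Σmasks≈Σsplits n [] _ ne bd D F = trans (Σmasks-agreeing n D F) (sym (+-identityʳ _))
  Σmasks≈Σsplits n (c ∷ cs) (c-disj , cs-disj) ne bd D F = begin
      Σl (λ b → indicator (all (constantOn b) (c ∷ cs) ∧ agreesOff n b D (c ∷ cs)) (F b)) (masks n)
    ≈⟨ Σl-cong (masks n) (λ b → reflexive (P.cong (λ z → indicator z (F b))
         (∧-assoc (constantOn b c) (all (constantOn b) cs) (agreesOff n b D (c ∷ cs))))) ⟩
      Σl (λ b → indicator (constantOn b c ∧ (all (constantOn b) cs ∧ agreesOff n b D (c ∷ cs))) (F b)) (masks n)
    ≈⟨ Σl-cong (masks n) (λ b → trans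
         (indicator-∨-disjoint (all (bitAt b) c) (all (not ∘ bitAt b) c) (all (constantOn b) cs) (agreesOff n b D (c ∷ cs)) (F b) (TF b))
         (+-cong (reflexive (P.cong (λ z → indicator (all (constantOn b) cs ∧ z) (F b)) (P.sym (agreeT b))))
                 (reflexive (P.cong (λ z → indicator (all (constantOn b) cs ∧ z) (F b)) (P.sym (agreeF b)))))) ⟩
      Σl (λ b → indicator (all (constantOn b) cs ∧ agreesOff n b Dt cs) (F b) + indicator (all (constantOn b) cs ∧ agreesOff n b Df cs) (F b)) (masks n)
    ≈⟨ Σl-+ _ _ (masks n) ⟩
      Σl (λ b → indicator (all (constantOn b) cs ∧ agreesOff n b Dt cs) (F b)) (masks n) + Σl (λ b → indicator (all (constantOn b) cs ∧ agreesOff n b Df cs) (F b)) (masks n)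
    ≈⟨ +-cong (Σmasks≈Σsplits n cs cs-disj (λ c' m → ne c' (there m)) (λ c' i m → bd c' i (there m)) Dt F)
              (Σmasks≈Σsplits n cs cs-disj (λ c' m → ne c' (there m)) (λ c' i m → bd c' i (there m)) Df F) ⟩
      Σl (λ st → F (tabulateBits n (splitMask Dt cs (proj₁ st)))) (splits cs) + Σl (λ st → F (tabulateBits n (splitMask Df cs (proj₁ st)))) (splits cs)
    ≈⟨ sym (Σl-+ _ _ (splits cs)) ⟩
      Σl (λ st → F (tabulateBits n (splitMask Dt cs (proj₁ st))) + F (tabulateBits n (splitMask Df cs (proj₁ st)))) (splits cs)
    ≈⟨ Σl-cong (splits cs) (λ st → +-cong
         (reflexive (P.cong F (tabulateBits-cong n _ _ (λ i _ → mt (proj₁ st) i))))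
         (trans (reflexive (P.cong F (tabulateBits-cong n _ _ (λ i _ → mf (proj₁ st) i)))) (sym (+-identityʳ _)))) ⟩
      Σl (λ st → Σl (λ st' → F (tabulateBits n (splitMask D (c ∷ cs) (proj₁ st'))))
                    ((c ∷ proj₁ st , proj₂ st) ∷ (proj₁ st , c ∷ proj₂ st) ∷ [])) (splits cs)
    ≈⟨ sym (Σl-concatMap _ _ (splits cs)) ⟩
      Σl (λ st → F (tabulateBits n (splitMask D (c ∷ cs) (proj₁ st)))) (splits (c ∷ cs)) ∎
    where open AddCycle n c cs c-disj (ne c (here P.refl)) (λ i m → bd c i (here P.refl) m) D


module CycleSplits where

  open import Data.List.Relation.Unary.All using ([]; _∷_)
  open Basics
  open Cycles
  open Restriction
  open import Relation.Binary.PropositionalEquality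

  All-concatMap : ∀ {A B : Set} {P : B → Set} (g : A → List B) xs → All (λ x → All P (g x)) xs → All P (concatMap g xs)
  All-concatMap g [] [] = []
  All-concatMap g (x ∷ xs) (p ∷ ps) = AP.++⁺ p (All-concatMap g xs ps)

  IsSplitOf : List (List ℕ) → List (List ℕ) × List (List ℕ) → Set
  IsSplitOf cs st = (∀ i → (inUnion (proj₁ st) i ∨ inUnion (proj₂ st) i) ≡ inUnion cs i) ×
             (∀ c → c ∈ proj₁ st → c ∈ cs) × (∀ c → c ∈ proj₂ st → c ∈ cs)

  splits-IsSplitOf : ∀ cs → All (IsSplitOf cs) (splits cs)
  splits-IsSplitOf [] = ((λ i → refl) , (λ c ()) , (λ c ())) ∷ []
  splits-IsSplitOf (c ∷ cs) = All-concatMap _ (splits cs) (Data.List.Relation.Unary.All.map lem (splits-IsSplitOf cs))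
    where
    lem : ∀ {st} → IsSplitOf cs st → All (IsSplitOf (c ∷ cs)) ((c ∷ proj₁ st , proj₂ st) ∷ (proj₁ st , c ∷ proj₂ st) ∷ [])
    lem {s , t} (p , q , r) =
      ((λ i → trans (∨-assoc (elemᵇ i c) (inUnion s i) (inUnion t i)) (cong (elemᵇ i c ∨_) (p i))) ,
       (λ { c' (here e) → here e ; c' (there m) → there (q c' m) }) ,
       (λ c' m → there (r c' m))) ∷
      ((λ i → trans (sym (∨-assoc (inUnion s i) (elemᵇ i c) (inUnion t i)))
                (trans (cong (_∨ inUnion t i) (∨-comm (inUnion s i) (elemᵇ i c)))
                  (trans (∨-assoc (elemᵇ i c) (inUnion s i) (inUnion t i)) (cong (elemᵇ i c ∨_) (p i))))) ,
       (λ c' m → there (q c' m)) ,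
       (λ { c' (here e) → here e ; c' (there m) → there (r c' m) })) ∷ []

  splits-disjoint : ∀ cs → Disjoint cs → All (λ st → ∀ i → (inUnion (proj₁ st) i ∧ inUnion (proj₂ st) i) ≡ false) (splits cs)
  splits-disjoint [] _ = (λ i → refl) ∷ []
  splits-disjoint (c ∷ cs) (c-disj , cs-disj) = All-concatMap _ (splits cs)
    (Data.List.Relation.Unary.All.zipWith (λ { {s , t} (h , (p , _ , _)) → lem s t h p })
       (splits-disjoint cs cs-disj , splits-IsSplitOf cs))
    where
    lem : ∀ s t → (∀ i → (inUnion s i ∧ inUnion t i) ≡ false) → (∀ i → (inUnion s i ∨ inUnion t i) ≡ inUnion cs i) →
          All (λ st → ∀ i → (inUnion (proj₁ st) i ∧ inUnion (proj₂ st) i) ≡ false) ((c ∷ s , t) ∷ (s , c ∷ t) ∷ [])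
    lem s t h p = l1 ∷ l2 ∷ []
      where
      tcs : ∀ i → inUnion t i ≡ true → inUnion cs i ≡ true
      tcs i e = trans (sym (p i)) (∨-introʳ {inUnion s i} e)
      scs : ∀ i → inUnion s i ≡ true → inUnion cs i ≡ true
      scs i e = trans (sym (p i)) (∨-introˡ e)
      l1 : ∀ i → ((elemᵇ i c ∨ inUnion s i) ∧ inUnion t i) ≡ false
      l1 i with elemᵇ i c in ec
      ... | true = ¬-not λ e → t≢f (trans (sym (tcs i e)) (c-disj i (elemᵇ-∈ i c ec)))
      ... | false = h i
      l2 : ∀ i → (inUnion s i ∧ (elemᵇ i c ∨ inUnion t i)) ≡ false
      l2 i with elemᵇ i c in ec
      ... | true = ¬-not λ e → t≢f (trans (sym (scs i (∧-conicalˡ _ _ e))) (c-disj i (elemᵇ-∈ i c ec)))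
      ... | false = h i

  partition⇒not : ∀ x y → (x ∨ y) ≡ true → (x ∧ y) ≡ false → y ≡ not x
  partition⇒not true false e d = refl
  partition⇒not false true e d = refl
  partition⇒not true true e ()
  partition⇒not false false () d

  module _ (σ : List ℕ) (G : IsPermMap σ) where
    private n = length σ

    split-complement : ∀ s t → IsSplitOf (cycles σ) (s , t) → (∀ i → (inUnion s i ∧ inUnion t i) ≡ false) → ∀ i → i < n → inUnion t i ≡ not (inUnion s i)
    split-complement s t (p , _ , _) d i i<n = partition⇒not _ _ (trans (p i) (cycles-cover σ G i i<n)) (d i)

    splits-grading : All (λ st → length (restrictTo σ (proj₁ st)) ℕ.+ length (restrictTo σ (proj₂ st)) ≡ length σ) (splits (cycles σ))
    splits-grading = AllM.zipWith (λ { {s , t} (sp , d) → lem s t sp d }) (splits-IsSplitOf (cycles σ) , splits-disjoint (cycles σ) (cycles-disjoint σ G))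
      where
      lem : ∀ s t → IsSplitOf (cycles σ) (s , t) → (∀ i → (inUnion s i ∧ inUnion t i) ≡ false) →
            length (restrictTo σ s) ℕ.+ length (restrictTo σ t) ≡ length σ
      lem s t sp d = trans (cong₂ ℕ._+_ (length-map _ (filterᵇ (inUnion s) (upTo n)))
                        (trans (length-map _ (filterᵇ (inUnion t) (upTo n)))
                          (cong length (filter-cong _ (not ∘ inUnion s) (upTo n) (λ i m → split-complement s t sp d i (∈-upTo⁻ m))))))
                     (trans (length-filter-not (inUnion s) (upTo n)) (length-upTo n))

  splits-IsPermMap : ∀ σ (G : IsPermMap σ) → All (λ st → IsPermMap (restrictTo σ (proj₁ st)) × IsPermMap (restrictTo σ (proj₂ st))) (splits (cycles σ))
  splits-IsPermMap σ G = AllM.map (λ { {s , t} (_ , qs , qt) → Restricted.IsPermMap-restricted σ G (inUnion s) (cl s qs) , Restricted.IsPermMap-restricted σ G (inUnion t) (cl t qt) })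
                            (splits-IsSplitOf (cycles σ))
    where
    cl : ∀ s → (∀ c → c ∈ s → c ∈ cycles σ) → Closed σ (inUnion s)
    cl s sub i i<n = any-cong _ _ s (λ c mc → cycle-closed σ G c i (sub c mc) i<n)


module Coproduct {c ℓ} (R : CommutativeRing c ℓ) where

  open import Data.List.Relation.Unary.All using ([]; _∷_)
  open Basics
  open Cycles
  open Restriction
  open Merging
  open MergedTerms
  open Masks
  open CycleSplits
  open import Data.Nat.Properties using (+-cancelˡ-≡)
  open import Relation.Binary.PropositionalEquality as P using (_≡_)

  open CommutativeRing R
  open FiniteSums R
  open Shuffles R
  open MaskedSums R
  open import Relation.Binary.Reasoning.Setoid setoid

  φ-length≢ : ∀ ρ w → ¬ length w ≡ length ρ → φ ρ w ≈ 0#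
  φ-length≢ ρ w ne rewrite ≢⇒≡ᵇ-false (length w) (length ρ) ne = refl

  φ-[] : ∀ ρ → φ ρ [] ≡ ε ρ
  φ-[] [] = P.refl
  φ-[] (x ∷ ρ) = P.refl

  φ-tag : ∀ σ f → (∀ x y → f x ≡ f y → x ≡ y) → ∀ w → φ σ (map (tag f) w) ≡ φ σ w
  φ-tag σ f inj w = P.cong (λ z → if z then 1# else 0#) (isTermOf-tag σ f inj w)

  Δφ-splits : ∀ σ u v → Δφ σ u v ≡ Σl (λ st → φ (restrictTo σ (proj₁ st)) u * φ (restrictTo σ (proj₂ st)) v) (splits (cycles σ))
  Δφ-splits σ u v = Σl-map _ _ (splits (cycles σ))

  indicator-∧-product : ∀ (cc x y : Bool) → (if (cc ∧ (x ∧ y)) then 1# else 0#) ≈ indicator cc ((if x then 1# else 0#) * (if y then 1# else 0#))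
  indicator-∧-product false x y = refl
  indicator-∧-product true true true = sym (*-identityˡ _)
  indicator-∧-product true true false = sym (zeroʳ _)
  indicator-∧-product true false y = sym (zeroˡ _)

  module DoubledAlphabet (σ : List ℕ) (G : IsPermMap σ) (f0 f1 : ℕ → ℕ)
    (inj0 : ∀ x y → f0 x ≡ f0 y → x ≡ y) (inj1 : ∀ x y → f1 x ≡ f1 y → x ≡ y) (disj : ∀ x y → ¬ f0 x ≡ f1 y)
    (u v : Monomial) where
    n = length σ
    U' = map (tag f0) u
    V' = map (tag f1) v
    -- Every position lies in a cycle of σ, so the default bit is never read.
    D : ℕ → Bool
    D _ = false
    Gb : List Bool → Carrier
    Gb b = φ (restrictBy σ (bitAt b)) u * φ (restrictBy σ (bitAt (map not b))) v

    mask-term : length u ℕ.+ length v ≡ n → ∀ b → b ∈ masks n →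
      indicator (trues b ℕ.≡ᵇ length U') (φ σ (merge b U' V')) ≈ indicator (constantOnCycles σ b ∧ agreesOff n b D (cycles σ)) (Gb b)
    mask-term eN b mb rewrite length-map (tag f0) u with trues b ℕ.≡ᵇ length u in ec
    ... | true = begin
          φ σ t
        ≈⟨ reflexive (P.cong (λ z → if z then 1# else 0#) (MergedWord.isTermOf-merge σ G f0 f1 inj0 inj1 disj b lb u v cu cv)) ⟩
          (if constantOnCycles σ b ∧ (isTermOf σ1 u ∧ isTermOf σ2 v) then 1# else 0#)
        ≈⟨ indicator-∧-product (constantOnCycles σ b) _ _ ⟩
          indicator (constantOnCycles σ b) (Gb b)
        ≈⟨ reflexive (P.cong (λ z → indicator z (Gb b)) (P.sym (P.trans (P.cong (constantOnCycles σ b ∧_) agr) (∧-identityʳ _)))) ⟩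
          indicator (constantOnCycles σ b ∧ agreesOff n b D (cycles σ)) (Gb b) ∎
      where
      lb = masks-length n mb
      cu = ≡ᵇ≡true⇒≡ _ _ ec
      cv : falses b ≡ length v
      cv = +-cancelˡ-≡ (trues b) (falses b) (length v) (P.trans (trues+falses b) (P.trans lb (P.trans (P.sym eN) (P.cong (ℕ._+ length v) (P.sym cu)))))
      t = merge b U' V'
      σ1 = restrictBy σ (bitAt b)
      σ2 = restrictBy σ (bitAt (map not b))
      agr : agreesOff n b D (cycles σ) ≡ true
      agr = agreesOff-intro n b D (cycles σ) (λ i i<n q → ⊥-elim (t≢f (P.trans (P.sym (cycles-cover σ G i i<n)) q)))
    ... | false = sym (lem (constantOnCycles σ b ∧ agreesOff n b D (cycles σ)))
      where
      lb = masks-length n mb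
      z1 : φ (restrictBy σ (bitAt b)) u ≈ 0#
      z1 = φ-length≢ (restrictBy σ (bitAt b)) u (λ e → t≢f (P.trans (P.sym (≡⇒≡ᵇ≡true (P.trans (P.sym (length-restrictBy-bitAt σ b lb)) (P.sym e)))) ec))
      lem : ∀ x → indicator x (Gb b) ≈ 0#
      lem true = trans (*-congʳ z1) (zeroˡ _)
      lem false = refl

    restrict-splitMask : ∀ s t → IsSplitOf (cycles σ) (s , t) → (∀ i → (inUnion s i ∧ inUnion t i) ≡ false) →
      (restrictBy σ (bitAt (tabulateBits n (splitMask D (cycles σ) s))) ≡ restrictTo σ s) ×
      (restrictBy σ (bitAt (map not (tabulateBits n (splitMask D (cycles σ) s)))) ≡ restrictTo σ t)
    restrict-splitMask s t sp d = restrictBy-cong σ _ _ h1 , restrictBy-cong σ _ _ h2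
      where
      h1 : ∀ i → i < n → bitAt (tabulateBits n (splitMask D (cycles σ) s)) i ≡ inUnion s i
      h1 i i<n rewrite bitAt-tabulateBits n (splitMask D (cycles σ) s) i i<n | cycles-cover σ G i i<n with inUnion s i
      ... | true = P.refl
      ... | false = P.refl
      lenmk : length (tabulateBits n (splitMask D (cycles σ) s)) ≡ n
      lenmk = P.trans (length-map _ (upTo n)) (length-upTo n)
      h2 : ∀ i → i < n → bitAt (map not (tabulateBits n (splitMask D (cycles σ) s))) i ≡ inUnion t i
      h2 i i<n = P.trans (bitAt-map-not (tabulateBits n (splitMask D (cycles σ) s)) i (P.subst (i <_) (P.sym lenmk) i<n))
                   (P.trans (P.cong not (h1 i i<n)) (P.sym (split-complement σ G s t sp d i i<n)))

    Δφ≈Σshuffle : Δφ σ u v ≈ Σshuffle U' V' (φ σ)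
    Δφ≈Σshuffle with length u ℕ.+ length v ≟ n
    ... | no ne = trans (reflexive (Δφ-splits σ u v)) (trans (Σl-cong-All (splits (cycles σ)) (AllM.map (λ {st} → tz st) (splits-grading σ G)))
                        (trans (Σl-0 (λ _ → 0#) (splits (cycles σ)) (λ _ → refl)) (sym rhs0)))
      where
      tz : ∀ st → length (restrictTo σ (proj₁ st)) ℕ.+ length (restrictTo σ (proj₂ st)) ≡ n →
           φ (restrictTo σ (proj₁ st)) u * φ (restrictTo σ (proj₂ st)) v ≈ 0#
      tz (s , t) e with length u ≟ length (restrictTo σ s)
      ... | yes e1 = trans (*-congˡ (φ-length≢ (restrictTo σ t) v (λ e2 → ne (P.trans (P.cong₂ ℕ._+_ e1 e2) e)))) (zeroʳ _)
      ... | no e1 = trans (*-congʳ (φ-length≢ (restrictTo σ s) u e1)) (zeroˡ _)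
      rhs0 : Σshuffle U' V' (φ σ) ≈ 0#
      rhs0 = trans (Σshuffle-ext U' V' (λ w e → φ-length≢ σ w (λ e' → ne (P.trans (P.sym (P.cong₂ ℕ._+_ (length-map _ u) (length-map _ v))) (P.trans (P.sym e) e'))))) (Σshuffle-0 U' V')
    ... | yes eN = begin
        Δφ σ u v
      ≡⟨ Δφ-splits σ u v ⟩
        Σl (λ st → φ (restrictTo σ (proj₁ st)) u * φ (restrictTo σ (proj₂ st)) v) (splits (cycles σ))
      ≈⟨ sym (Σl-cong-All (splits (cycles σ)) (AllM.zipWith (λ { {s , t} (sp , d) →
            let (e1 , e2) = restrict-splitMask s t sp d in reflexive (P.cong₂ (λ p q → φ p u * φ q v) e1 e2) })
            (splits-IsSplitOf (cycles σ) , splits-disjoint (cycles σ) (cycles-disjoint σ G)))) ⟩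
        Σl (λ st → Gb (tabulateBits n (splitMask D (cycles σ) (proj₁ st)))) (splits (cycles σ))
      ≈⟨ sym (Σmasks≈Σsplits n (cycles σ) (cycles-disjoint σ G) (cycle-nonempty σ G) (cycle-bounded σ G) D Gb) ⟩
        Σl (λ b → indicator (constantOnCycles σ b ∧ agreesOff n b D (cycles σ)) (Gb b)) (masks n)
      ≈⟨ sym (Σl-cong-∈ (masks n) (mask-term eN)) ⟩
        Σl (λ b → indicator (trues b ℕ.≡ᵇ length U') (φ σ (merge b U' V'))) (masks n)
      ≡⟨ P.cong (λ z → Σl (λ b → indicator (trues b ℕ.≡ᵇ length U') (φ σ (merge b U' V'))) (masks z))
           (P.sym (P.trans (P.cong₂ ℕ._+_ (length-map _ u) (length-map _ v)) eN)) ⟩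
        Σl (λ b → indicator (trues b ℕ.≡ᵇ length U') (φ σ (merge b U' V'))) (masks (length U' ℕ.+ length V'))
      ≈⟨ sym (Σshuffle≈Σmasks U' V' (φ σ)) ⟩
        Σshuffle U' V' (φ σ) ∎


module Tagging where

  open Basics
  open import Data.Nat using (_*_)
  open import Data.Nat.Properties using (*-cancelʳ-≡; suc-injective)
  open import Relation.Binary.PropositionalEquality

  isOdd : ℕ → Bool
  isOdd zero = false
  isOdd (suc n) = not (isOdd n)

  isOdd-even : ∀ x → isOdd (x * 2) ≡ false
  isOdd-even zero = refl
  isOdd-even (suc x) = trans (not-involutive (isOdd (x * 2))) (isOdd-even x)

  isOdd-odd : ∀ x → isOdd (suc (x * 2)) ≡ true
  isOdd-odd x = cong not (isOdd-even x)

  -- left and right split ℕ into two alphabets; joinRight merges the right half of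
  -- a doubled left alphabet into the right alphabet, so that (Δ ⊗ id) Δ and
  -- (id ⊗ Δ) Δ can be compared inside one tripled alphabet.
  left right leftLeft joinRight : ℕ → ℕ
  left x = x * 2
  right x = suc (x * 2)
  leftLeft x = left (left x)
  joinRight n = if isOdd n then n else suc n * 2

  left-injective : ∀ x y → left x ≡ left y → x ≡ y
  left-injective x y e = *-cancelʳ-≡ x y 2 e

  right-injective : ∀ x y → right x ≡ right y → x ≡ y
  right-injective x y e = left-injective x y (suc-injective e)

  left≢right : ∀ x y → ¬ left x ≡ right y
  left≢right x y e = t≢f (trans (sym (isOdd-odd y)) (trans (cong isOdd (sym e)) (isOdd-even x)))

  leftLeft-injective : ∀ x y → leftLeft x ≡ leftLeft y → x ≡ y
  leftLeft-injective x y e = left-injective x y (left-injective _ _ e)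

  joinRight-left : ∀ y → joinRight (left y) ≡ left (right y)
  joinRight-left y rewrite isOdd-even y = refl

  joinRight-right : ∀ z → joinRight (right z) ≡ right z
  joinRight-right z rewrite isOdd-odd z = refl

  joinRight-injective : ∀ p q → joinRight p ≡ joinRight q → p ≡ q
  joinRight-injective p q e with isOdd p in ep | isOdd q in eq
  ... | true | true = e
  ... | false | false = suc-injective (*-cancelʳ-≡ (suc p) (suc q) 2 e)
  ... | true | false = ⊥-elim (t≢f (trans (sym ep) (trans (cong isOdd e) (isOdd-even (suc q)))))
  ... | false | true = ⊥-elim (t≢f (trans (sym eq) (trans (cong isOdd (sym e)) (isOdd-even (suc p)))))

  leftLeft≢joinRight : ∀ x y → ¬ leftLeft x ≡ joinRight y
  leftLeft≢joinRight x y e with isOdd y in ey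
  ... | true = t≢f (trans (sym ey) (trans (cong isOdd (sym e)) (isOdd-even (x * 2))))
  ... | false = t≢f (trans (sym (trans (cong not ey) refl)) (trans (cong isOdd (sym (*-cancelʳ-≡ (x * 2) (suc y) 2 e))) (isOdd-even x)))

module Bialgebra {c ℓ} (R : CommutativeRing c ℓ) where

  open import Data.List.Relation.Unary.All using ([]; _∷_)
  open Basics
  open Cycles
  open Restriction
  open Merging
  open MergedTerms using (tag)
  open CycleSplits
  open Tagging
  open import Relation.Binary.PropositionalEquality as P using (_≡_)

  open CommutativeRing R
  open FiniteSums R
  open Shuffles R
  open Coproduct R
  open import Relation.Binary.Reasoning.Setoid setoid

  Δφ≈Σshuffle-lr : ∀ σ → IsPermMap σ → ∀ u v → Δφ σ u v ≈ Σshuffle (map (tag left) u) (map (tag right) v) (φ σ)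
  Δφ≈Σshuffle-lr σ G u v = DoubledAlphabet.Δφ≈Σshuffle σ G left right left-injective right-injective left≢right u v

  Δφ≈Σshuffle-joined : ∀ σ → IsPermMap σ → ∀ u v → Δφ σ u v ≈ Σshuffle (map (tag leftLeft) u) (map (tag joinRight) v) (φ σ)
  Δφ≈Σshuffle-joined σ G u v = DoubledAlphabet.Δφ≈Σshuffle σ G leftLeft joinRight leftLeft-injective joinRight-injective leftLeft≢joinRight u v

  Σsplits-cong-IsPermMap : ∀ σ → IsPermMap σ → ∀ (F F' : List ℕ → List ℕ → Carrier) →
    (∀ s t → IsPermMap s → IsPermMap t → F s t ≈ F' s t) →
    Σl (λ st → F (restrictTo σ (proj₁ st)) (restrictTo σ (proj₂ st))) (splits (cycles σ)) ≈
    Σl (λ st → F' (restrictTo σ (proj₁ st)) (restrictTo σ (proj₂ st))) (splits (cycles σ))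
  Σsplits-cong-IsPermMap σ G F F' h = Σl-cong-All (splits (cycles σ)) (AllM.map (λ { (g1 , g2) → h _ _ g1 g2 }) (splits-IsPermMap σ G))

  Δ-cocommutative : ∀ (σ : List ℕ) → IsPerm σ → ∀ u v → Δφ σ u v ≈ Δφ σ v u
  Δ-cocommutative σ _ u v = begin
      Δφ σ u v
    ≡⟨ Δφ-splits σ u v ⟩
      Σl (λ st → φ (restrictTo σ (proj₁ st)) u * φ (restrictTo σ (proj₂ st)) v) (splits (cycles σ))
    ≈⟨ Σsplits-swap (cycles σ) _ ⟩
      Σl (λ st → φ (restrictTo σ (proj₂ st)) u * φ (restrictTo σ (proj₁ st)) v) (splits (cycles σ))
    ≈⟨ Σl-cong (splits (cycles σ)) (λ st → *-comm _ _) ⟩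
      Σl (λ st → φ (restrictTo σ (proj₁ st)) v * φ (restrictTo σ (proj₂ st)) u) (splits (cycles σ))
    ≡⟨ P.sym (Δφ-splits σ v u) ⟩
      Δφ σ v u ∎

  Δ-graded : ∀ (σ : List ℕ) → IsPerm σ →
      All (λ pq → length (proj₁ pq) ℕ.+ length (proj₂ pq) ≡ length σ) (ΔTerms σ)
  Δ-graded σ p = AP.map⁺ (splits-grading σ (IsPerm⇒IsPermMap σ p))

  ⋆-graded : ∀ (σ τ : List ℕ) → IsPerm σ → IsPerm τ →
      ∀ w → ¬ (length w ≡ length σ ℕ.+ length τ) → (φ σ ⋆ φ τ) w ≈ 0#
  ⋆-graded σ τ _ _ w ne = Σl-0 _ (upTo (suc (length w))) λ k → lem k
    where
    lw : ∀ k → length (take k w) ℕ.+ length (drop k w) ≡ length w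
    lw k = P.trans (P.sym (length-++ (take k w))) (P.cong length (take++drop≡id k w))
    lem : ∀ k → φ σ (take k w) * φ τ (drop k w) ≈ 0#
    lem k with length (take k w) ≟ length σ
    ... | yes e = trans (*-congˡ (φ-length≢ τ (drop k w) (λ e2 → ne (P.trans (P.sym (lw k)) (P.cong₂ ℕ._+_ e e2))))) (zeroʳ _)
    ... | no e = trans (*-congʳ (φ-length≢ σ (take k w) e)) (zeroˡ _)

  Δ-unital : ∀ u v → Δφ [] u v ≈ φ [] u * φ [] v
  Δ-unital u v = +-identityʳ _

  ε-multiplicative : ∀ (σ τ : List ℕ) → IsPerm σ → IsPerm τ →
      (cs : List (Carrier × List ℕ)) → All (λ cρ → IsPerm (proj₂ cρ)) cs →
      (∀ w → (φ σ ⋆ φ τ) w ≈ lin cs w) →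
      εlin cs ≈ ε σ * ε τ
  ε-multiplicative σ τ _ _ cs _ h = begin
      εlin cs
    ≈⟨ Σl-cong cs (λ cρ → *-congˡ (reflexive (P.sym (φ-[] (proj₂ cρ))))) ⟩
      lin cs []
    ≈⟨ sym (h []) ⟩
      φ σ [] * φ τ [] + 0#
    ≈⟨ +-identityʳ _ ⟩
      φ σ [] * φ τ []
    ≡⟨ P.cong₂ _*_ (φ-[] σ) (φ-[] τ) ⟩
      ε σ * ε τ ∎

  Δ-counital : ∀ (σ : List ℕ) → IsPerm σ → ∀ w → (εidΔφ σ w ≈ φ σ w) × (idεΔφ σ w ≈ φ σ w)
  Δ-counital σ p w = l1 , l2
    where
    G = IsPerm⇒IsPermMap σ p
    l1 : εidΔφ σ w ≈ φ σ w
    l1 = begin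
        εidΔφ σ w
      ≈⟨ Σl-cong (ΔTerms σ) (λ pq → *-congʳ (reflexive (P.sym (φ-[] (proj₁ pq))))) ⟩
        Δφ σ [] w
      ≈⟨ Δφ≈Σshuffle-lr σ G [] w ⟩
        Σshuffle [] (map (tag right) w) (φ σ)
      ≡⟨ Σshuffle-[]ˡ (map (tag right) w) (φ σ) ⟩
        φ σ (map (tag right) w)
      ≡⟨ φ-tag σ right right-injective w ⟩
        φ σ w ∎
    l2 : idεΔφ σ w ≈ φ σ w
    l2 = begin
        idεΔφ σ w
      ≈⟨ Σl-cong (ΔTerms σ) (λ pq → *-congˡ (reflexive (P.sym (φ-[] (proj₂ pq))))) ⟩
        Δφ σ w []
      ≈⟨ Δφ≈Σshuffle-lr σ G w [] ⟩
        Σshuffle (map (tag left) w) [] (φ σ)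
      ≡⟨ Σshuffle-[]ʳ (map (tag left) w) (φ σ) ⟩
        φ σ (map (tag left) w)
      ≡⟨ φ-tag σ left left-injective w ⟩
        φ σ w ∎

  Δ-multiplicative : ∀ (σ τ : List ℕ) → IsPerm σ → IsPerm τ →
      (cs : List (Carrier × List ℕ)) → All (λ cρ → IsPerm (proj₂ cρ)) cs →
      (∀ w → (φ σ ⋆ φ τ) w ≈ lin cs w) →
      ∀ u v → Δlin cs u v ≈ (Δφ σ ⊛ Δφ τ) u v
  Δ-multiplicative σ τ pσ pτ cs pcs h u v = begin
      Δlin cs u v
    ≈⟨ Σl-cong-All cs (AllM.map (λ {cρ} p → *-congˡ (Δφ≈Σshuffle-lr (proj₂ cρ) (IsPerm⇒IsPermMap _ p) u v)) pcs) ⟩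
      Σl (λ cρ → proj₁ cρ * Σshuffle U' V' (φ (proj₂ cρ))) cs
    ≈⟨ Σl-cong cs (λ cρ → Σshuffle-*ˡ U' V' (proj₁ cρ) (φ (proj₂ cρ))) ⟩
      Σl (λ cρ → Σshuffle U' V' (λ t → proj₁ cρ * φ (proj₂ cρ) t)) cs
    ≈⟨ sym (Σshuffle-Σl U' V' (λ t cρ → proj₁ cρ * φ (proj₂ cρ) t) cs) ⟩
      Σshuffle U' V' (lin cs)
    ≈⟨ Σshuffle-cong U' V' (λ t → trans (sym (h t)) (⋆≈Σdeconc (φ σ) (φ τ) t)) ⟩
      Σshuffle U' V' (Σdeconc H)
    ≈⟨ Σshuffle-Σdeconc U' V' H ⟩
      Σdeconc (λ p q → Σdeconc (λ p' q' → Σshuffle p p' (λ t → Σshuffle q q' (H t))) V') U'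
    ≡⟨ Σdeconc-map (tag left) _ u ⟩
      Σdeconc (λ p q → Σdeconc (λ p' q' → Σshuffle (map (tag left) p) p' (λ t → Σshuffle (map (tag left) q) q' (H t))) V') u
    ≈⟨ Σdeconc-cong u (λ p q → trans (reflexive (Σdeconc-map (tag right) _ v)) (Σdeconc-cong v (λ p' q' → inner p p' q q'))) ⟩
      Σdeconc (λ p q → Σdeconc (λ p' q' → Δφ σ p p' * Δφ τ q q') v) u
    ≈⟨ sym (⊛≈Σdeconc (Δφ σ) (Δφ τ) u v) ⟩
      (Δφ σ ⊛ Δφ τ) u v ∎
    where
    U' = map (tag left) u
    V' = map (tag right) v
    H : Monomial → Monomial → Carrier
    H p q = φ σ p * φ τ q
    Gσ = IsPerm⇒IsPermMap σ pσ
    Gτ = IsPerm⇒IsPermMap τ pτ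
    inner : ∀ p p' q q' →
      Σshuffle (map (tag left) p) (map (tag right) p') (λ t → Σshuffle (map (tag left) q) (map (tag right) q') (H t)) ≈ Δφ σ p p' * Δφ τ q q'
    inner p p' q q' = begin
        Σshuffle (map (tag left) p) (map (tag right) p') (λ t1 → Σshuffle (map (tag left) q) (map (tag right) q') (λ t2 → φ σ t1 * φ τ t2))
      ≈⟨ Σshuffle-cong (map (tag left) p) (map (tag right) p') (λ t1 → sym (Σshuffle-*ˡ (map (tag left) q) (map (tag right) q') (φ σ t1) (φ τ))) ⟩
        Σshuffle (map (tag left) p) (map (tag right) p') (λ t1 → φ σ t1 * Σshuffle (map (tag left) q) (map (tag right) q') (φ τ))
      ≈⟨ sym (Σshuffle-*ʳ (map (tag left) p) (map (tag right) p') _ (φ σ)) ⟩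
        Σshuffle (map (tag left) p) (map (tag right) p') (φ σ) * Σshuffle (map (tag left) q) (map (tag right) q') (φ τ)
      ≈⟨ sym (*-cong (Δφ≈Σshuffle-lr σ Gσ p p') (Δφ≈Σshuffle-lr τ Gτ q q')) ⟩
        Δφ σ p p' * Δφ τ q q' ∎

  tag³ : Monomial → Monomial → Monomial → Monomial × Monomial × Monomial
  tag³ u v w = map (tag left) (map (tag left) u) , map (tag left) (map (tag right) v) , map (tag right) w

  ΔidΔφ≈Σshuffle³ : ∀ σ → IsPermMap σ → ∀ u v w → let (A , B , C) = tag³ u v w in
    ΔidΔφ σ u v w ≈ Σshuffle A B (λ x → Σshuffle x C (φ σ))
  ΔidΔφ≈Σshuffle³ σ G u v w = begin
      ΔidΔφ σ u v w
    ≡⟨ Σl-map _ _ (splits (cycles σ)) ⟩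
      Σl (λ st → Δφ (restrictTo σ (proj₁ st)) u v * φ (restrictTo σ (proj₂ st)) w) (splits (cycles σ))
    ≈⟨ Σsplits-cong-IsPermMap σ G _ (λ s t → Σshuffle U' V' (φ s) * φ t w) (λ s t gs gt → *-congʳ (Δφ≈Σshuffle-lr s gs u v)) ⟩
      Σl (λ st → Σshuffle U' V' (φ (restrictTo σ (proj₁ st))) * φ (restrictTo σ (proj₂ st)) w) (splits (cycles σ))
    ≈⟨ Σl-cong (splits (cycles σ)) (λ st → Σshuffle-*ʳ U' V' _ _) ⟩
      Σl (λ st → Σshuffle U' V' (λ x → φ (restrictTo σ (proj₁ st)) x * φ (restrictTo σ (proj₂ st)) w)) (splits (cycles σ))
    ≈⟨ sym (Σshuffle-Σl U' V' (λ x st → φ (restrictTo σ (proj₁ st)) x * φ (restrictTo σ (proj₂ st)) w) (splits (cycles σ))) ⟩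
      Σshuffle U' V' (λ x → Σl (λ st → φ (restrictTo σ (proj₁ st)) x * φ (restrictTo σ (proj₂ st)) w) (splits (cycles σ)))
    ≈⟨ Σshuffle-cong U' V' (λ x → trans (reflexive (P.sym (Δφ-splits σ x w))) (Δφ≈Σshuffle-lr σ G x w)) ⟩
      Σshuffle U' V' (λ x → Σshuffle (map (tag left) x) (map (tag right) w) (φ σ))
    ≡⟨ P.sym (Σshuffle-map (tag left) U' V' (λ y → Σshuffle y (map (tag right) w) (φ σ))) ⟩
      Σshuffle (map (tag left) U') (map (tag left) V') (λ x → Σshuffle x (map (tag right) w) (φ σ)) ∎
    where
    U' = map (tag left) u
    V' = map (tag right) v

  idΔΔφ≈Σshuffle³ : ∀ σ → IsPermMap σ → ∀ u v w → let (A , B , C) = tag³ u v w in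
    idΔΔφ σ u v w ≈ Σshuffle B C (λ y → Σshuffle A y (φ σ))
  idΔΔφ≈Σshuffle³ σ G u v w = sym (begin
      Σshuffle B C (λ y → Σshuffle A y (φ σ))
    ≡⟨ P.cong₂ (λ b c → Σshuffle b c (λ y → Σshuffle A y (φ σ))) eB eC ⟩
      Σshuffle (map (tag joinRight) V0) (map (tag joinRight) W1) (λ y → Σshuffle A y (φ σ))
    ≡⟨ Σshuffle-map (tag joinRight) V0 W1 (λ y → Σshuffle A y (φ σ)) ⟩
      Σshuffle V0 W1 (λ y → Σshuffle A (map (tag joinRight) y) (φ σ))
    ≡⟨ P.cong (λ a → Σshuffle V0 W1 (λ y → Σshuffle a (map (tag joinRight) y) (φ σ))) eA ⟩
      Σshuffle V0 W1 (λ y → Σshuffle (map (tag leftLeft) u) (map (tag joinRight) y) (φ σ))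
    ≈⟨ Σshuffle-cong V0 W1 (λ y → trans (sym (Δφ≈Σshuffle-joined σ G u y)) (reflexive (Δφ-splits σ u y))) ⟩
      Σshuffle V0 W1 (λ y → Σl (λ st → φ (restrictTo σ (proj₁ st)) u * φ (restrictTo σ (proj₂ st)) y) (splits (cycles σ)))
    ≈⟨ Σshuffle-Σl V0 W1 (λ y st → φ (restrictTo σ (proj₁ st)) u * φ (restrictTo σ (proj₂ st)) y) (splits (cycles σ)) ⟩
      Σl (λ st → Σshuffle V0 W1 (λ y → φ (restrictTo σ (proj₁ st)) u * φ (restrictTo σ (proj₂ st)) y)) (splits (cycles σ))
    ≈⟨ Σl-cong (splits (cycles σ)) (λ st → sym (Σshuffle-*ˡ V0 W1 _ _)) ⟩
      Σl (λ st → φ (restrictTo σ (proj₁ st)) u * Σshuffle V0 W1 (φ (restrictTo σ (proj₂ st)))) (splits (cycles σ))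
    ≈⟨ Σsplits-cong-IsPermMap σ G (λ s t → φ s u * Σshuffle V0 W1 (φ t)) _ (λ s t gs gt → *-congˡ (sym (Δφ≈Σshuffle-lr t gt v w))) ⟩
      Σl (λ st → φ (restrictTo σ (proj₁ st)) u * Δφ (restrictTo σ (proj₂ st)) v w) (splits (cycles σ))
    ≡⟨ P.sym (Σl-map _ _ (splits (cycles σ))) ⟩
      idΔΔφ σ u v w ∎)
    where
    A = map (tag left) (map (tag left) u)
    B = map (tag left) (map (tag right) v)
    C = map (tag right) w
    V0 = map (tag left) v
    W1 = map (tag right) w
    eA : A ≡ map (tag leftLeft) u
    eA = P.sym (map-∘ u)
    eB : B ≡ map (tag joinRight) V0
    eB = P.trans (P.sym (map-∘ v)) (P.trans (map-cong (λ q → P.cong (_, proj₂ q) (P.sym (joinRight-left (proj₁ q)))) v) (map-∘ v))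
    eC : C ≡ map (tag joinRight) W1
    eC = P.trans (map-cong (λ q → P.cong (_, proj₂ q) (P.sym (joinRight-right (proj₁ q)))) w) (map-∘ w)

  Δ-coassociative : ∀ (σ : List ℕ) → IsPerm σ → ∀ u v w → ΔidΔφ σ u v w ≈ idΔΔφ σ u v w
  Δ-coassociative σ p u v w =
    let G = IsPerm⇒IsPermMap σ p
        (A , B , C) = tag³ u v w
    in trans (ΔidΔφ≈Σshuffle³ σ G u v w) (trans (Σshuffle-assoc A B C (φ σ)) (sym (idΔΔφ≈Σshuffle³ σ G u v w)))


mainTheorem8 : ∀ {c ℓ} (K : Field c ℓ) → CharZero K →
  let open Field K
      open Series commutativeRing
  in
  -- Δ is multiplicative: if φ_σ φ_τ = Σ c_ρ φ_ρ then Σ c_ρ Δφ_ρ = Δφ_σ · Δφ_τ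
  (∀ (σ τ : List ℕ) → IsPerm σ → IsPerm τ →
    (cs : List (Carrier × List ℕ)) → All (λ cρ → IsPerm (proj₂ cρ)) cs →
    (∀ w → (φ σ ⋆ φ τ) w ≈ lin cs w) →
    ∀ u v → Δlin cs u v ≈ (Δφ σ ⊛ Δφ τ) u v)
  -- Δ is unital: Δ(1) = 1 ⊗ 1
  × (∀ u v → Δφ [] u v ≈ φ [] u * φ [] v)
  -- ε is multiplicative
  × (∀ (σ τ : List ℕ) → IsPerm σ → IsPerm τ →
    (cs : List (Carrier × List ℕ)) → All (λ cρ → IsPerm (proj₂ cρ)) cs →
    (∀ w → (φ σ ⋆ φ τ) w ≈ lin cs w) →
    εlin cs ≈ ε σ * ε τ)
  -- coassociativity
  × (∀ (σ : List ℕ) → IsPerm σ → ∀ u v w → ΔidΔφ σ u v w ≈ idΔΔφ σ u v w)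
  -- counit
  × (∀ (σ : List ℕ) → IsPerm σ → ∀ w → (εidΔφ σ w ≈ φ σ w) × (idεΔφ σ w ≈ φ σ w))
  -- grading: φ_σ φ_τ is homogeneous of degree n + m, and Δ preserves degree
  × (∀ (σ τ : List ℕ) → IsPerm σ → IsPerm τ →
    ∀ w → ¬ (length w ≡ length σ ℕ.+ length τ) → (φ σ ⋆ φ τ) w ≈ 0#)
  × (∀ (σ : List ℕ) → IsPerm σ →
    All (λ pq → length (proj₁ pq) ℕ.+ length (proj₂ pq) ≡ length σ) (ΔTerms σ))
  -- cocommutativity
  × (∀ (σ : List ℕ) → IsPerm σ → ∀ u v → Δφ σ u v ≈ Δφ σ v u)
mainTheorem8 K _ = Δ-multiplicative , Δ-unital , ε-multiplicative , Δ-coassociative , Δ-counital , ⋆-graded , Δ-graded , Δ-cocommutative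
  where open Bialgebra (Field.commutativeRing K)
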